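{- Let $\Lambda$ be a self-dual lattice sequence in $V$ and let $a_1,a_2$ be non-zero elements of the normalizer $\mathfrak{n}(\Lambda)$, each of which is symmetric or skew-symmetric (i.e. $\sigma(a_k)=\pm a_k$), such that $a_1a_2^{ -1}\in\tilde U^s(\Lambda)=1+\mathfrak{a}_s(\Lambda)$ for some integer $s>0$. Then there is an $F$-linear isometry from $(V,h_{a_1})$ to $(V,h_{a_2})$ lying in $\tilde U^s(\Lambda)$.
   Context: $F$ is a non-archimedean local field of odd residual characteristic with ring of integers $o_F$, maximal ideal $\mathfrak{p}_F$; $\rho$ is a field automorphism of $F$ of order at most $2$, and a uniformizer $\pi$ with $\rho(\pi)\in\{\pi,-\pi\}$ is fixed; $\epsilon\in\{\pm1\}$, and $h$ is a nondegenerate $\epsilon$-hermitian form on a finite-dimensional $F$-vector space $V$ (scalars on the right): $h(vx,wy)=\rho(x)\epsilon\rho(h(w,v))y$. $A=\operatorname{End}_F(V)$, $\sigma$ is the adjoint anti-involution ($h(av,w)=h(v,\sigma(a)w)$). For an invertible $\gamma\in A$ with $\sigma(\gamma)=\pm\gamma$, $h_\gamma(v,w)=h(v,\gamma w)$. An $o_F$-lattice sequence is a map $s\mapsto\Lambda_s$ from $\mathbb{Z}$ to free $o_F$-submodules of rank $\dim_FV$ with $\Lambda_s\subseteq\Lambda_t$ for $s>t$ and some $e\ge1$ with $\Lambda_s\pi=\Lambda_{s+e}$. $\mathfrak{a}_n(\Lambda)=\{x\in A:x\Lambda_s\subseteq\Lambda_{s+n}\forall s\}$, $\nu_\Lambda(x)=\sup\{n:x\in\mathfrak{a}_n(\Lambda)\}$,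 $\mathfrak{n}(\Lambda)=\{g\in A^\times:\nu_\Lambda(g^{ -1})=-\nu_\Lambda(g)\}$. $M^\#=\{v:h(v,M)\subseteq\mathfrak{p}_F\}$; $\Lambda$ is self-dual if $(\Lambda_s)^\#=\Lambda_{u-s}$ for some $u$ and all $s$. -}

module Defs where

open import Level using (0ℓ)
open import Algebra.Bundles using (CommutativeRing)
open import Data.Nat as ℕ using (ℕ)
open import Data.Integer as ℤ using (ℤ; +_)
open import Data.Fin using (Fin; zero; suc; _≟_)
open import Data.Maybe using (Maybe; just; nothing)
open import Data.List using (List)
open import Data.List.Relation.Unary.All using (All)
open import Data.List.Relation.Unary.Any using (Any)
open import Data.Product using (Σ; _×_; _,_)
open import Data.Sum using (_⊎_)
open import Relation.Nullary using (¬_; does)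
open import Relation.Binary.PropositionalEquality using (_≡_)
open import Function.Bundles using (_⇔_)
open import Data.Bool using (if_then_else_)

-- Non-archimedean local fields: a field (commutative ring with
-- inverses of non-zero elements) with a normalised discrete valuation
-- val : F → ℤ ∪ {∞} (∞ = nothing), complete, with finite residue field.

module _ (R : CommutativeRing 0ℓ 0ℓ) where
  open CommutativeRing R using (Carrier; _≈_; _+_; _*_; -_; 0#; 1#)

  infixl 6 _−_
  _−_ : Carrier → Carrier → Carrier
  x − y = x + (- y)

  -- x ≥ᵥ n  means  val x ≥ n  (always true when val x = ∞)
  _≥[_]_ : (Carrier → Maybe ℤ) → Carrier → ℤ → Set
  _≥[_]_ val x n = ∀ m → val x ≡ just m → n ℤ.≤ m

  record IsNALocalField : Set where
    field
      0≉1     : ¬ (0# ≈ 1#)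
      inverse : ∀ x → ¬ (x ≈ 0#) → Σ Carrier λ y → x * y ≈ 1#
      val      : Carrier → Maybe ℤ
      val-cong : ∀ {x y} → x ≈ y → val x ≡ val y
      val-∞⇒0  : ∀ x → val x ≡ nothing → x ≈ 0#
      val-0    : val 0# ≡ nothing
      val-mul  : ∀ x y m n → val x ≡ just m → val y ≡ just n →
                 val (x * y) ≡ just (m ℤ.+ n)
      val-ultra : ∀ x y n → val ≥[ x ] n → val ≥[ y ] n → val ≥[ x + y ] n
      -- normalised: a uniformizer exists
      has-uniformizer : Σ Carrier λ ϖ → val ϖ ≡ just (+ 1)
      complete : (x : ℕ → Carrier) →
        (∀ N → Σ ℕ λ M → ∀ m n → M ℕ.≤ m → M ℕ.≤ n → val ≥[ x m − x n ] (+ N)) →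
        Σ Carrier λ L → ∀ N → Σ ℕ λ M → ∀ n → M ℕ.≤ n → val ≥[ x n − L ] (+ N)
      residue-finite : Σ (List Carrier) λ reps →
        All (λ r → val ≥[ r ] (+ 0)) reps ×
        (∀ x → val ≥[ x ] (+ 0) → Any (λ r → val ≥[ x − r ] (+ 1)) reps)

  -- odd residual characteristic: 2 is a unit of o_F
  OddResidualChar : IsNALocalField → Set
  OddResidualChar F = IsNALocalField.val F (1# + 1#) ≡ just (+ 0)

  record IsAutOrderLe2 (ρ : Carrier → Carrier) : Set where
    field
      ρ-cong : ∀ {x y} → x ≈ y → ρ x ≈ ρ y
      ρ-+    : ∀ x y → ρ (x + y) ≈ ρ x + ρ y
      ρ-*    : ∀ x y → ρ (x * y) ≈ ρ x * ρ y
      ρ-1    : ρ 1# ≈ 1#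
      ρ-invol : ∀ x → ρ (ρ x) ≈ x

  -- V = F^d (column vectors, scalars acting on the right), A = End_F(V)
  -- realised as d×d matrices.

  Vec : ℕ → Set
  Vec d = Fin d → Carrier

  Mat : ℕ → Set
  Mat d = Fin d → Fin d → Carrier

  sumF : ∀ {n} → (Fin n → Carrier) → Carrier
  sumF {ℕ.zero}  f = 0#
  sumF {ℕ.suc n} f = f zero + sumF (λ i → f (suc i))

  _≈ᵥ_ : ∀ {d} → Vec d → Vec d → Set
  v ≈ᵥ w = ∀ i → v i ≈ w i

  _≈ₘ_ : ∀ {d} → Mat d → Mat d → Set
  a ≈ₘ b = ∀ i j → a i j ≈ b i j

  0ᵥ : ∀ {d} → Vec d
  0ᵥ i = 0#

  _+ᵥ_ : ∀ {d} → Vec d → Vec d → Vec d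
  (v +ᵥ w) i = v i + w i

  _·_ : ∀ {d} → Vec d → Carrier → Vec d
  (v · x) i = v i * x

  _$_ : ∀ {d} → Mat d → Vec d → Vec d
  (a $ v) i = sumF λ j → a i j * v j

  _∘ₘ_ : ∀ {d} → Mat d → Mat d → Mat d
  (a ∘ₘ b) i k = sumF λ j → a i j * b j k

  _−ₘ_ : ∀ {d} → Mat d → Mat d → Mat d
  (a −ₘ b) i j = a i j − b i j

  1ₘ : ∀ {d} → Mat d
  1ₘ i j = if does (i ≟ j) then 1# else 0#

  0ₘ : ∀ {d} → Mat d
  0ₘ i j = 0#

  IsInverse : ∀ {d} → Mat d → Mat d → Set
  IsInverse a b = ((a ∘ₘ b) ≈ₘ 1ₘ) × ((b ∘ₘ a) ≈ₘ 1ₘ)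

  Invertible : ∀ {d} → Mat d → Set
  Invertible a = Σ (Mat _) λ b → IsInverse a b

  Form : ℕ → Set
  Form d = Vec d → Vec d → Carrier

  record IsNondegEpsHermitian (ρ : Carrier → Carrier) (ε : Carrier)
                              {d : ℕ} (h : Form d) : Set where
    field
      h-cong  : ∀ {v v' w w'} → v ≈ᵥ v' → w ≈ᵥ w' → h v w ≈ h v' w'
      h-+ˡ    : ∀ v v' w → h (v +ᵥ v') w ≈ h v w + h v' w
      h-+ʳ    : ∀ v w w' → h v (w +ᵥ w') ≈ h v w + h v w'
      h-herm  : ∀ v w x y → h (v · x) (w · y) ≈ ρ x * ε * ρ (h w v) * y
      nondeg  : ∀ v → (∀ w → h v w ≈ 0#) → v ≈ᵥ 0ᵥ

  twist : ∀ {d} → Form d → Mat d → Form d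
  twist h γ v w = h v (γ $ w)

  -- σ(a) = a  resp.  σ(a) = -a, where σ is the adjoint anti-involution
  -- of h:  h(a v, w) = h(v, σ(a) w).
  IsSymmetric : ∀ {d} → Form d → Mat d → Set
  IsSymmetric h a = ∀ v w → h (a $ v) w ≈ h v (a $ w)

  IsSkew : ∀ {d} → Form d → Mat d → Set
  IsSkew h a = ∀ v w → h (a $ v) w ≈ - h v (a $ w)

  module _ (F : IsNALocalField) where
    open IsNALocalField F using (val)

    Integral : Carrier → Set
    Integral x = val ≥[ x ] (+ 0)

    InP : Carrier → Set
    InP x = val ≥[ x ] (+ 1)

    Subset : ℕ → Set₁
    Subset d = Vec d → Set

    _≐_ : ∀ {d} → Subset d → Subset d → Set
    M ≐ N = ∀ v → (M v ⇔ N v)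

    _⊆_ : ∀ {d} → Subset d → Subset d → Set
    M ⊆ N = ∀ v → M v → N v

    -- free o_F-submodule of V of rank d = dim V: the o_F-span of the
    -- columns of an invertible matrix B (an o_F-basis of M)
    IsFullLattice : ∀ {d} → Subset d → Set
    IsFullLattice {d} M = Σ (Mat d) λ B → Invertible B ×
      (∀ v → M v ⇔ (Σ (Vec d) λ x → (∀ i → Integral (x i)) × (v ≈ᵥ (B $ x))))

    scaleSet : ∀ {d} → Subset d → Carrier → Subset d
    scaleSet M π v = Σ (Vec _) λ w → M w × (v ≈ᵥ (w · π))

    IsLatticeSequence : ∀ {d} → Carrier → (ℤ → Subset d) → Set
    IsLatticeSequence π Λ =
      (∀ s → IsFullLattice (Λ s)) ×
      (∀ s t → t ℤ.< s → Λ s ⊆ Λ t) ×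
      (Σ ℕ λ e → 1 ℕ.≤ e × (∀ s → Λ (s ℤ.+ + e) ≐ scaleSet (Λ s) π))

    InA : ∀ {d} → (ℤ → Subset d) → ℤ → Mat d → Set
    InA Λ n x = ∀ s v → Λ s v → Λ (s ℤ.+ n) (x $ v)

    -- ν_Λ(x) = n  (sup of {m : x ∈ a_m(Λ)}, attained since ℤ-valued)
    NuIs : ∀ {d} → (ℤ → Subset d) → Mat d → ℤ → Set
    NuIs Λ x n = InA Λ n x × (∀ m → InA Λ m x → m ℤ.≤ n)

    InNormalizer : ∀ {d} → (ℤ → Subset d) → Mat d → Set
    InNormalizer Λ g = Σ (Mat _) λ g⁻¹ → IsInverse g g⁻¹ ×
      (Σ ℤ λ n → NuIs Λ g n × NuIs Λ g⁻¹ (ℤ.- n))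

    dual : ∀ {d} → Form d → Subset d → Subset d
    dual h M v = ∀ w → M w → InP (h v w)

    IsSelfDual : ∀ {d} → Form d → (ℤ → Subset d) → Set
    IsSelfDual h Λ = Σ ℤ λ u → ∀ s → dual h (Λ s) ≐ Λ (u ℤ.- s)

    InU : ∀ {d} → (ℤ → Subset d) → ℤ → Mat d → Set
    InU Λ s g = InA Λ s (g −ₘ 1ₘ)

  IsIsometry : ∀ {d} → Form d → Form d → Mat d → Set
  IsIsometry h₁ h₂ g = Invertible g × (∀ v w → h₂ (g $ v) (g $ w) ≈ h₁ v w)

module Submission where

-- Write h(a_k v, w) = δ_k h(v, a_k w) with δ_k = ±1 and put
-- w = a₂⁻¹a₁ ∈ Ũ^s(Λ).  A key identity relates h(a₁a₂⁻¹v, q) to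
-- δ₁δ₂ h(v, wq).
--  * If δ₁δ₂ = -1, it gives 2h(Λ_r, Λ_{u-r-s}) ⊆ 𝔭, so by self-duality
--    (2 being a unit) Λ_r ⊆ Λ_{r+s} for all r, forcing V = 0: impossible.
--  * If δ₁δ₂ = 1, w is self-adjoint for h_{a₂}, and Newton's iteration
--    G ↦ G - ½(G² - w) converges (completeness of F) to a self-adjoint
--    square root g ∈ Ũ^s(Λ) of w; then h_{a₂}(gv, gu) = h_{a₂}(v, g²u)
--    = h_{a₁}(v, u), so g is the required isometry.

open import Defs
open import Level using (0ℓ)
open import Algebra.Bundles using (CommutativeRing; AbelianGroup)
open import Data.Nat as ℕ using (ℕ)
import Data.Nat.Properties as NP
open import Data.Integer as ℤ using (ℤ; +_)
import Data.Integer.Properties as ℤP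
open import Data.Integer.Tactic.RingSolver using (solve-∀)
open import Algebra.Properties.Group (AbelianGroup.group ℤP.+-0-abelianGroup)
  using () renaming (∙-cancelˡ to ℤ+-cancelˡ)
open import Data.Fin using (Fin; zero; suc; _≟_)
open import Data.Bool using (if_then_else_)
open import Data.Maybe using (just; nothing)
open import Data.Empty using (⊥; ⊥-elim)
open import Data.Product using (Σ; _×_; _,_; proj₁; proj₂)
open import Data.Sum using (_⊎_; inj₁; inj₂)
open import Relation.Nullary using (¬_; does; yes; no)
open import Relation.Binary.PropositionalEquality as P using (_≡_; _≢_)
open import Relation.Binary.Bundles using (Setoid)
import Relation.Binary.Reasoning.Setoid
open import Function.Bundles using (Equivalence; _⇔_)

module Matrices (R : CommutativeRing 0ℓ 0ℓ) where
  open CommutativeRing R renaming (Carrier to K) hiding (zero)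
  open import Algebra.Properties.Ring ring public using (-‿distribˡ-*; -‿distribʳ-*; -1*x≈-x)
  open import Algebra.Properties.AbelianGroup +-abelianGroup public using (⁻¹-∙-comm)
  open import Algebra.Properties.Group +-group public
    using (⁻¹-involutive; inverseˡ-unique; inverseʳ-unique; identityˡ-unique; x∙y⁻¹≈ε⇒x≈y)
  import Algebra.Properties.Semiring.Sum semiring as Sum
  open import Tactic.RingSolver.Core.AlmostCommutativeRing using (fromCommutativeRing)
  import Tactic.RingSolver.NonReflective
  module Solver = Tactic.RingSolver.NonReflective (fromCommutativeRing R (λ _ → nothing))
  open Solver using (solve; _⊜_; ⊝_) renaming (_⊕_ to _:+_)
  module ≈-Reasoning = Relation.Binary.Reasoning.Setoid setoid

  [x-y]+y≈x : ∀ x y → (x + - y) + y ≈ x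
  [x-y]+y≈x x y = trans (+-assoc x (- y) y) (trans (+-congˡ (-‿inverseˡ y)) (+-identityʳ x))

  x-y≈[x-z]+[z-y] : ∀ x y z → x + - y ≈ (x + - z) + (z + - y)
  x-y≈[x-z]+[z-y] x y z = begin
    x + - y                   ≈⟨ +-congʳ (sym ([x-y]+y≈x x z)) ⟩
    ((x + - z) + z) + - y     ≈⟨ +-assoc (x + - z) z (- y) ⟩
    (x + - z) + (z + - y)     ∎
    where open ≈-Reasoning

  x-y≈-[y-x] : ∀ x y → x + - y ≈ - (y + - x)
  x-y≈-[y-x] x y = sym (begin
    - (y + - x)               ≈⟨ sym (⁻¹-∙-comm y (- x)) ⟩
    - y + - - x               ≈⟨ +-congˡ (⁻¹-involutive x) ⟩
    - y + x                   ≈⟨ +-comm (- y) x ⟩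
    x + - y                   ∎)
    where open ≈-Reasoning

  x-y≈[x-z]-[y-z] : ∀ x y z → x + - y ≈ (x + - z) + - (y + - z)
  x-y≈[x-z]-[y-z] x y z = trans (x-y≈[x-z]+[z-y] x y z) (+-congˡ (x-y≈-[y-x] z y))

  -1*-1≈1 : - 1# * - 1# ≈ 1#
  -1*-1≈1 = trans (-1*x≈-x (- 1#)) (⁻¹-involutive 1#)

  [x-y]-z≈[x-z]-y : ∀ x y z → (x + - y) + - z ≈ (x + - z) + - y
  [x-y]-z≈[x-z]-y = solve 3 (λ x y z → ((x :+ (⊝ y)) :+ (⊝ z)) ⊜ ((x :+ (⊝ z)) :+ (⊝ y))) refl

  V : ℕ → Set
  V = Vec R

  M : ℕ → Set
  M = Mat R

  ∑ : ∀ {n} → (Fin n → K) → K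
  ∑ = sumF R

  ∑≡sum : ∀ {n} (f : Fin n → K) → ∑ f ≡ Sum.sum f
  ∑≡sum {ℕ.zero} f = P.refl
  ∑≡sum {ℕ.suc n} f = P.cong (λ x → f zero + x) (∑≡sum (λ i → f (suc i)))

  ∑-cong : ∀ {n} {f g : Fin n → K} → (∀ i → f i ≈ g i) → ∑ f ≈ ∑ g
  ∑-cong {f = f} {g} e =
    P.subst₂ _≈_ (P.sym (∑≡sum f)) (P.sym (∑≡sum g)) (Sum.sum-cong-≋ e)

  ∑-0 : ∀ {n} → ∑ {n} (λ _ → 0#) ≈ 0#
  ∑-0 {n} = P.subst (_≈ 0#) (P.sym (∑≡sum {n} (λ _ → 0#))) (Sum.sum-replicate-zero n)

  ∑-+ : ∀ {n} (f g : Fin n → K) → ∑ (λ i → f i + g i) ≈ ∑ f + ∑ g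
  ∑-+ {n} f g = P.subst₂ _≈_ (P.sym (∑≡sum {n} (λ i → f i + g i))) (P.sym (P.cong₂ _+_ (∑≡sum f) (∑≡sum g)))
              (Sum.∑-distrib-+ f g)

  ∑-*ˡ : ∀ {n} (c : K) (f : Fin n → K) → ∑ (λ i → c * f i) ≈ c * ∑ f
  ∑-*ˡ {n} c f = P.subst₂ _≈_ (P.sym (∑≡sum {n} (λ i → c * f i))) (P.sym (P.cong (c *_) (∑≡sum f)))
               (sym (Sum.*-distribˡ-sum c f))

  ∑-*ʳ : ∀ {n} (c : K) (f : Fin n → K) → ∑ (λ i → f i * c) ≈ ∑ f * c
  ∑-*ʳ {n} c f = P.subst₂ _≈_ (P.sym (∑≡sum {n} (λ i → f i * c))) (P.sym (P.cong (_* c) (∑≡sum f)))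
               (sym (Sum.*-distribʳ-sum c f))

  ∑-swap : ∀ {m n} (f : Fin m → Fin n → K) →
           ∑ (λ i → ∑ (λ j → f i j)) ≈ ∑ (λ j → ∑ (λ i → f i j))
  ∑-swap {m} {n} f = begin
    ∑ (λ i → ∑ (λ j → f i j))              ≈⟨ ∑-cong {m} (λ i → reflexive (∑≡sum (f i))) ⟩
    ∑ (λ i → Sum.sum (f i))                ≡⟨ ∑≡sum {m} (λ i → Sum.sum (f i)) ⟩
    Sum.sum (λ i → Sum.sum (f i))          ≈⟨ Sum.∑-comm f ⟩
    Sum.sum (λ j → Sum.sum (λ i → f i j))  ≡⟨ P.sym (∑≡sum {n} (λ j → Sum.sum (λ i → f i j))) ⟩
    ∑ (λ j → Sum.sum (λ i → f i j))        ≈⟨ ∑-cong {n} (λ j → reflexive (P.sym (∑≡sum (λ i → f i j)))) ⟩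
    ∑ (λ j → ∑ (λ i → f i j))              ∎
    where open ≈-Reasoning

  ∑-neg : ∀ {n} (f : Fin n → K) → ∑ (λ i → - f i) ≈ - ∑ f
  ∑-neg {n} f = begin
    ∑ (λ i → - f i)         ≈⟨ ∑-cong {n} (λ i → sym (-1*x≈-x (f i))) ⟩
    ∑ (λ i → - 1# * f i)    ≈⟨ ∑-*ˡ (- 1#) f ⟩
    - 1# * ∑ f              ≈⟨ -1*x≈-x (∑ f) ⟩
    - ∑ f                   ∎
    where open ≈-Reasoning

  δ : ∀ {n} → Fin n → Fin n → K
  δ i j = if does (i ≟ j) then 1# else 0#

  δ-sym : ∀ {n} (i j : Fin n) → δ i j ≈ δ j i
  δ-sym i j with i ≟ j | j ≟ i
  ... | yes _ | yes _ = refl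
  ... | no _  | no _  = refl
  ... | yes p | no q  = ⊥-elim (q (P.sym p))
  ... | no p  | yes q = ⊥-elim (p (P.sym q))

  δ-refl : ∀ {n} (i : Fin n) → δ i i ≈ 1#
  δ-refl i with i ≟ i
  ... | yes _ = refl
  ... | no i≢i = ⊥-elim (i≢i P.refl)

  δ-suc : ∀ {n} (i j : Fin n) → δ (suc i) (suc j) ≈ δ i j
  δ-suc i j with i ≟ j
  ... | yes _ = refl
  ... | no _  = refl

  ∑-δ : ∀ {n} (j : Fin n) (f : Fin n → K) → ∑ (λ i → δ i j * f i) ≈ f j
  ∑-δ {ℕ.suc n} zero f = begin
    1# * f zero + ∑ (λ i → δ (suc i) zero * f (suc i)) ≈⟨ +-cong (*-identityˡ _) (∑-cong {n} (λ i → zeroˡ _)) ⟩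
    f zero + ∑ {n} (λ _ → 0#)                          ≈⟨ +-congˡ (∑-0 {n}) ⟩
    f zero + 0#                                        ≈⟨ +-identityʳ _ ⟩
    f zero                                             ∎
    where open ≈-Reasoning
  ∑-δ {ℕ.suc n} (suc j) f = begin
    0# * f zero + ∑ (λ i → δ (suc i) (suc j) * f (suc i)) ≈⟨ +-cong (zeroˡ _) (∑-cong {n} (λ i → *-congʳ (δ-suc i j))) ⟩
    0# + ∑ (λ i → δ i j * f (suc i))                      ≈⟨ +-identityˡ _ ⟩
    ∑ (λ i → δ i j * f (suc i))                           ≈⟨ ∑-δ j (λ i → f (suc i)) ⟩
    f (suc j)                                             ∎
    where open ≈-Reasoning

  infix 4 _≈v_ _≋_
  _≈v_ : ∀ {d} → V d → V d → Set
  _≈v_ = _≈ᵥ_ R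
  _≋_ : ∀ {d} → M d → M d → Set
  _≋_ = _≈ₘ_ R

  ≈v-refl : ∀ {d} {v : V d} → v ≈v v
  ≈v-refl i = refl
  ≈v-sym : ∀ {d} {v w : V d} → v ≈v w → w ≈v v
  ≈v-sym e i = sym (e i)
  ≈v-trans : ∀ {d} {u v w : V d} → u ≈v v → v ≈v w → u ≈v w
  ≈v-trans e f i = trans (e i) (f i)

  ≋-refl : ∀ {d} {a : M d} → a ≋ a
  ≋-refl i j = refl
  ≋-sym : ∀ {d} {a b : M d} → a ≋ b → b ≋ a
  ≋-sym e i j = sym (e i j)
  ≋-trans : ∀ {d} {a b c : M d} → a ≋ b → b ≋ c → a ≋ c
  ≋-trans e f i j = trans (e i j) (f i j)

  matSetoid : ℕ → Setoid 0ℓ 0ℓ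
  matSetoid d = record
    { Carrier = M d ; _≈_ = _≋_
    ; isEquivalence = record { refl = ≋-refl ; sym = ≋-sym ; trans = ≋-trans } }
  module ≋-Reasoning {d : ℕ} = Relation.Binary.Reasoning.Setoid (matSetoid d)

  infixl 6 _+v_
  _+v_ : ∀ {d} → V d → V d → V d
  _+v_ = _+ᵥ_ R
  -v_ : ∀ {d} → V d → V d
  (-v v) i = - v i
  infixl 7 _·v_
  _·v_ : ∀ {d} → V d → K → V d
  _·v_ = _·_ R
  0v : ∀ {d} → V d
  0v i = 0#

  unit : ∀ {d} → Fin d → V d
  unit j i = δ i j

  infixr 7 _⊛_
  infixl 7 _⊙_ _⋆_
  infixl 6 _⊕_ _⊖_
  _⊛_ : ∀ {d} → M d → V d → V d
  _⊛_ = _$_ R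
  _⊙_ : ∀ {d} → M d → M d → M d
  _⊙_ = _∘ₘ_ R
  _⊕_ : ∀ {d} → M d → M d → M d
  (a ⊕ b) i j = a i j + b i j
  _⊖_ : ∀ {d} → M d → M d → M d
  _⊖_ = _−ₘ_ R
  _⋆_ : ∀ {d} → K → M d → M d
  (c ⋆ a) i j = c * a i j
  I : ∀ {d} → M d
  I = 1ₘ R
  O : ∀ {d} → M d
  O = 0ₘ R

  $-cong : ∀ {d} {a b : M d} {v w : V d} → a ≋ b → v ≈v w → a ⊛ v ≈v b ⊛ w
  $-cong {d} ea ev i = ∑-cong {d} (λ j → *-cong (ea i j) (ev j))
  $-congʳ : ∀ {d} (a : M d) {v w : V d} → v ≈v w → a ⊛ v ≈v a ⊛ w
  $-congʳ a = $-cong {a = a} ≋-refl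

  $-⊕ : ∀ {d} (a b : M d) (v : V d) → (a ⊕ b) ⊛ v ≈v a ⊛ v +v b ⊛ v
  $-⊕ {d} a b v i = trans (∑-cong {d} (λ j → distribʳ _ _ _)) (∑-+ (λ j → a i j * v j) (λ j → b i j * v j))
  $-⊖ : ∀ {d} (a b : M d) (v : V d) → (a ⊖ b) ⊛ v ≈v a ⊛ v +v -v (b ⊛ v)
  $-⊖ {d} a b v i = begin
    ∑ (λ j → (a i j + - b i j) * v j)         ≈⟨ ∑-cong {d} (λ j → trans (distribʳ _ _ _) (+-congˡ (sym (-‿distribˡ-* _ _)))) ⟩
    ∑ (λ j → a i j * v j + - (b i j * v j))   ≈⟨ ∑-+ (λ j → a i j * v j) (λ j → - (b i j * v j)) ⟩
    (a ⊛ v) i + ∑ (λ j → - (b i j * v j))     ≈⟨ +-congˡ (∑-neg (λ j → b i j * v j)) ⟩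
    (a ⊛ v) i + - (b ⊛ v) i                   ∎
    where open ≈-Reasoning
  $-⋆ : ∀ {d} (c : K) (a : M d) (v : V d) → (c ⋆ a) ⊛ v ≈v (a ⊛ v) ·v c
  $-⋆ {d} c a v i = trans (∑-cong {d} (λ j → trans (*-assoc c _ _) (*-comm c _))) (∑-*ʳ c (λ j → a i j * v j))
  $-+v : ∀ {d} (a : M d) (v w : V d) → a ⊛ (v +v w) ≈v a ⊛ v +v a ⊛ w
  $-+v {d} a v w i = trans (∑-cong {d} (λ j → distribˡ _ _ _)) (∑-+ (λ j → a i j * v j) (λ j → a i j * w j))
  $-·v : ∀ {d} (a : M d) (v : V d) (c : K) → a ⊛ (v ·v c) ≈v (a ⊛ v) ·v c
  $-·v {d} a v c i = trans (∑-cong {d} (λ j → sym (*-assoc _ _ _))) (∑-*ʳ c (λ j → a i j * v j))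
  $--v : ∀ {d} (a : M d) (v : V d) → a ⊛ (-v v) ≈v -v (a ⊛ v)
  $--v {d} a v i = trans (∑-cong {d} (λ j → sym (-‿distribʳ-* _ _))) (∑-neg (λ j → a i j * v j))
  $-0 : ∀ {d} (a : M d) → a ⊛ 0v ≈v 0v
  $-0 {d} a i = trans (∑-cong {d} (λ j → zeroʳ _)) (∑-0 {d})
  $-⊙ : ∀ {d} (a b : M d) (v : V d) → (a ⊙ b) ⊛ v ≈v a ⊛ (b ⊛ v)
  $-⊙ {d} a b v i = begin
    ∑ (λ k → ∑ (λ j → a i j * b j k) * v k)   ≈⟨ ∑-cong {d} (λ k → sym (∑-*ʳ (v k) (λ j → a i j * b j k))) ⟩
    ∑ (λ k → ∑ (λ j → a i j * b j k * v k))   ≈⟨ ∑-swap (λ k j → a i j * b j k * v k) ⟩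
    ∑ (λ j → ∑ (λ k → a i j * b j k * v k))   ≈⟨ ∑-cong {d} (λ j → trans (∑-cong {d} (λ k → *-assoc _ _ _)) (∑-*ˡ (a i j) (λ k → b j k * v k))) ⟩
    ∑ (λ j → a i j * ∑ (λ k → b j k * v k))   ∎
    where open ≈-Reasoning
  $-I : ∀ {d} (v : V d) → I ⊛ v ≈v v
  $-I {d} v i = trans (∑-cong {d} (λ j → *-congʳ (δ-sym i j))) (∑-δ i v)
  $-O : ∀ {d} (v : V d) → O ⊛ v ≈v 0v
  $-O {d} v i = trans (∑-cong {d} (λ j → zeroˡ _)) (∑-0 {d})
  $-unit : ∀ {d} (a : M d) (j : Fin d) → a ⊛ unit j ≈v (λ i → a i j)
  $-unit {d} a j i = trans (∑-cong {d} (λ k → *-comm _ _)) (∑-δ j (a i))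

  mat-ext : ∀ {d} {a b : M d} → (∀ v → a ⊛ v ≈v b ⊛ v) → a ≋ b
  mat-ext {a = a} {b} h i j = trans (sym ($-unit a j i)) (trans (h (unit j) i) ($-unit b j i))

  ⊙-cong : ∀ {d} {a a' b b' : M d} → a ≋ a' → b ≋ b' → a ⊙ b ≋ a' ⊙ b'
  ⊙-cong {d} ea eb i k = ∑-cong {d} (λ j → *-cong (ea i j) (eb j k))
  ⊕-cong : ∀ {d} {a a' b b' : M d} → a ≋ a' → b ≋ b' → a ⊕ b ≋ a' ⊕ b'
  ⊕-cong ea eb i j = +-cong (ea i j) (eb i j)
  ⊖-cong : ∀ {d} {a a' b b' : M d} → a ≋ a' → b ≋ b' → a ⊖ b ≋ a' ⊖ b'
  ⊖-cong ea eb i j = +-cong (ea i j) (-‿cong (eb i j))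
  ⋆-cong : ∀ {d} {c c' : K} {a a' : M d} → c ≈ c' → a ≋ a' → c ⋆ a ≋ c' ⋆ a'
  ⋆-cong ec ea i j = *-cong ec (ea i j)

  ⊙-assoc : ∀ {d} (a b c : M d) → (a ⊙ b) ⊙ c ≋ a ⊙ (b ⊙ c)
  ⊙-assoc a b c = mat-ext λ v →
    ≈v-trans ($-⊙ (a ⊙ b) c v) (≈v-trans ($-⊙ a b (c ⊛ v))
      (≈v-sym (≈v-trans ($-⊙ a (b ⊙ c) v) ($-congʳ a ($-⊙ b c v)))))
  ⊙-Iˡ : ∀ {d} (a : M d) → I ⊙ a ≋ a
  ⊙-Iˡ a = mat-ext λ v → ≈v-trans ($-⊙ I a v) ($-I (a ⊛ v))
  ⊙-Iʳ : ∀ {d} (a : M d) → a ⊙ I ≋ a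
  ⊙-Iʳ a = mat-ext λ v → ≈v-trans ($-⊙ a I v) ($-congʳ a ($-I v))
  ⊙-⊖ˡ : ∀ {d} (a b c : M d) → a ⊙ (b ⊖ c) ≋ a ⊙ b ⊖ a ⊙ c
  ⊙-⊖ˡ a b c = mat-ext λ v →
    ≈v-trans ($-⊙ a (b ⊖ c) v) (≈v-trans ($-congʳ a ($-⊖ b c v))
      (≈v-trans ($-+v a (b ⊛ v) (-v (c ⊛ v)))
        (≈v-trans (λ i → +-cong (sym ($-⊙ a b v i)) (trans ($--v a (c ⊛ v) i) (-‿cong (sym ($-⊙ a c v i)))))
          (≈v-sym ($-⊖ (a ⊙ b) (a ⊙ c) v)))))
  ⊙-⊖ʳ : ∀ {d} (a b c : M d) → (a ⊖ b) ⊙ c ≋ a ⊙ c ⊖ b ⊙ c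
  ⊙-⊖ʳ a b c = mat-ext λ v →
    ≈v-trans ($-⊙ (a ⊖ b) c v) (≈v-trans ($-⊖ a b (c ⊛ v))
      (≈v-trans (λ i → +-cong (sym ($-⊙ a c v i)) (-‿cong (sym ($-⊙ b c v i))))
        (≈v-sym ($-⊖ (a ⊙ c) (b ⊙ c) v))))
  ⋆-⊙ˡ : ∀ {d} c (a b : M d) → (c ⋆ a) ⊙ b ≋ c ⋆ (a ⊙ b)
  ⋆-⊙ˡ c a b = mat-ext λ v →
    ≈v-trans ($-⊙ (c ⋆ a) b v) (≈v-trans ($-⋆ c a (b ⊛ v))
      (≈v-trans (λ i → *-congʳ (sym ($-⊙ a b v i))) (≈v-sym ($-⋆ c (a ⊙ b) v))))
  ⋆-⊙ʳ : ∀ {d} c (a b : M d) → a ⊙ (c ⋆ b) ≋ c ⋆ (a ⊙ b)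
  ⋆-⊙ʳ c a b = mat-ext λ v →
    ≈v-trans ($-⊙ a (c ⋆ b) v) (≈v-trans ($-congʳ a ($-⋆ c b v))
      (≈v-trans ($-·v a (b ⊛ v) c) (≈v-trans (λ i → *-congʳ (sym ($-⊙ a b v i))) (≈v-sym ($-⋆ c (a ⊙ b) v)))))

  inverse-action : ∀ {d} {a b : M d} → a ⊙ b ≋ I → ∀ v → a ⊛ (b ⊛ v) ≈v v
  inverse-action {a = a} {b} ab v = ≈v-trans (≈v-sym ($-⊙ a b v)) (≈v-trans ($-cong ab ≈v-refl) ($-I v))

  inverse-unique : ∀ {d} {a b c : M d} → a ⊙ b ≋ I → c ⊙ a ≋ I → b ≋ c
  inverse-unique {a = a} {b} {c} ab ca =
    ≋-trans (≋-sym (⊙-Iˡ b)) (≋-trans (⊙-cong (≋-sym ca) ≋-refl)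
      (≋-trans (⊙-assoc c a b) (≋-trans (⊙-cong ≋-refl ab) (⊙-Iʳ c))))

  commutes-inverse : ∀ {d} {x y y⁻¹ : M d} → x ⊙ y ≋ y ⊙ x → y ⊙ y⁻¹ ≋ I → y⁻¹ ⊙ y ≋ I →
                     y⁻¹ ⊙ x ≋ x ⊙ y⁻¹
  commutes-inverse {x = x} {y} {y⁻¹} xy≋yx yy⁻¹≋I y⁻¹y≋I = begin
    y⁻¹ ⊙ x                   ≈⟨ ≋-sym (⊙-Iʳ _) ⟩
    (y⁻¹ ⊙ x) ⊙ I             ≈⟨ ⊙-cong ≋-refl (≋-sym yy⁻¹≋I) ⟩
    (y⁻¹ ⊙ x) ⊙ (y ⊙ y⁻¹)     ≈⟨ ⊙-assoc y⁻¹ x (y ⊙ y⁻¹) ⟩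
    y⁻¹ ⊙ (x ⊙ (y ⊙ y⁻¹))     ≈⟨ ⊙-cong ≋-refl (≋-sym (⊙-assoc x y y⁻¹)) ⟩
    y⁻¹ ⊙ ((x ⊙ y) ⊙ y⁻¹)     ≈⟨ ⊙-cong ≋-refl (⊙-cong xy≋yx ≋-refl) ⟩
    y⁻¹ ⊙ ((y ⊙ x) ⊙ y⁻¹)     ≈⟨ ⊙-cong ≋-refl (⊙-assoc y x y⁻¹) ⟩
    y⁻¹ ⊙ (y ⊙ (x ⊙ y⁻¹))     ≈⟨ ≋-sym (⊙-assoc y⁻¹ y (x ⊙ y⁻¹)) ⟩
    (y⁻¹ ⊙ y) ⊙ (x ⊙ y⁻¹)     ≈⟨ ⊙-cong y⁻¹y≋I ≋-refl ⟩
    I ⊙ (x ⊙ y⁻¹)             ≈⟨ ⊙-Iˡ _ ⟩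
    x ⊙ y⁻¹                   ∎
    where open ≋-Reasoning

module Signs (R : CommutativeRing 0ℓ 0ℓ) where
  open CommutativeRing R renaming (Carrier to K) hiding (zero)
  open Matrices R using (M; _⊛_; -1*x≈-x; -1*-1≈1)

  IsSign : K → Set
  IsSign δ = (δ ≈ 1#) ⊎ (δ ≈ - 1#)

  sign² : ∀ {δ} → IsSign δ → δ * δ ≈ 1#
  sign² (inj₁ δ≈1) = trans (*-cong δ≈1 δ≈1) (*-identityˡ 1#)
  sign² (inj₂ δ≈-1) = trans (*-cong δ≈-1 δ≈-1) -1*-1≈1

  sign-product : ∀ {δ δ'} → IsSign δ → IsSign δ' → IsSign (δ * δ')
  sign-product (inj₁ δ≈1) (inj₁ δ'≈1) = inj₁ (trans (*-cong δ≈1 δ'≈1) (*-identityˡ 1#))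
  sign-product (inj₁ δ≈1) (inj₂ δ'≈-1) = inj₂ (trans (*-cong δ≈1 δ'≈-1) (*-identityˡ _))
  sign-product (inj₂ δ≈-1) (inj₁ δ'≈1) = inj₂ (trans (*-cong δ≈-1 δ'≈1) (*-identityʳ _))
  sign-product (inj₂ δ≈-1) (inj₂ δ'≈-1) = inj₁ (trans (*-cong δ≈-1 δ'≈-1) -1*-1≈1)

  sign-of : ∀ {d} (h : Form R d) (a : M d) → IsSymmetric R h a ⊎ IsSkew R h a →
            Σ K λ δ → IsSign δ × (∀ v w → h (a ⊛ v) w ≈ δ * h v (a ⊛ w))
  sign-of h a (inj₁ symmetric) = 1# , inj₁ refl , λ v w → trans (symmetric v w) (sym (*-identityˡ _))
  sign-of h a (inj₂ skew) = - 1# , inj₂ refl , λ v w → trans (skew v w) (sym (-1*x≈-x _))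

-∣i∣≤i : ∀ i → ℤ.- (+ ℤ.∣ i ∣) ℤ.≤ i
-∣i∣≤i (+ n) = ℤP.neg-≤-pos
-∣i∣≤i ℤ.-[1+ n ] = ℤP.≤-refl

i≤∣i∣ : ∀ i → i ℤ.≤ + ℤ.∣ i ∣
i≤∣i∣ (+ n) = ℤP.≤-refl
i≤∣i∣ ℤ.-[1+ n ] = ℤ.-≤+

uniformBound : ∀ {m} (Q : Fin m → ℕ → Set) → (∀ i {a b} → a ℕ.≤ b → Q i a → Q i b) →
               (∀ i → Σ ℕ (Q i)) → Σ ℕ λ B → ∀ i → Q i B
uniformBound {ℕ.zero} Q mono h = 0 , λ ()
uniformBound {ℕ.suc m} Q mono h
  with h zero | uniformBound (λ i → Q (suc i)) (λ i → mono (suc i)) (λ i → h (suc i))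
... | B₀ , h₀ | B₁ , h₁ = B₀ ℕ.⊔ B₁ , λ { zero → mono zero (NP.m≤m⊔n B₀ B₁) h₀
                                          ; (suc i) → mono (suc i) (NP.m≤n⊔m B₀ B₁) (h₁ i) }

eventuallyAll : ∀ {m} (Q : Fin m → ℕ → Set) → (∀ i → Σ ℕ λ M → ∀ n → M ℕ.≤ n → Q i n) →
                Σ ℕ λ M → ∀ i n → M ℕ.≤ n → Q i n
eventuallyAll Q h with uniformBound (λ i M → ∀ n → M ℕ.≤ n → Q i n)
                                    (λ i le q n le' → q n (NP.≤-trans le le')) h
... | M , q = M , λ i n le → q i n le

module Valuation (R : CommutativeRing 0ℓ 0ℓ) (F : IsNALocalField R) where
  open CommutativeRing R renaming (Carrier to K) hiding (zero)
  open Matrices R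
  open IsNALocalField F

  infix 4 _∈𝔭^_
  _∈𝔭^_ : K → ℤ → Set
  x ∈𝔭^ n = _≥[_]_ R val x n

  just-injective : ∀ {a b : ℤ} → just a ≡ just b → a ≡ b
  just-injective P.refl = P.refl

  nothing≢just : ∀ {a : ℤ} → nothing ≢ just a
  nothing≢just ()

  val-zero : ∀ {x} → x ≈ 0# → val x ≡ nothing
  val-zero e = P.trans (val-cong e) val-0

  val-exact : ∀ {x m} → val x ≡ just m → x ∈𝔭^ m
  val-exact vx m' e = ℤP.≤-reflexive (just-injective (P.trans (P.sym vx) e))

  𝔭-zero : ∀ {x} n → x ≈ 0# → x ∈𝔭^ n
  𝔭-zero n e m vx with P.trans (P.sym (val-zero e)) vx
  ... | ()

  𝔭-cong : ∀ {x y n} → x ≈ y → x ∈𝔭^ n → y ∈𝔭^ n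
  𝔭-cong e h m vy = h m (P.trans (val-cong e) vy)

  𝔭-mono : ∀ {x n n'} → n' ℤ.≤ n → x ∈𝔭^ n → x ∈𝔭^ n'
  𝔭-mono le h m vx = ℤP.≤-trans le (h m vx)

  𝔭-+ : ∀ {x y n} → x ∈𝔭^ n → y ∈𝔭^ n → (x + y) ∈𝔭^ n
  𝔭-+ {x} {y} {n} = val-ultra x y n

  𝔭^∞⇒0 : ∀ x → (∀ n → x ∈𝔭^ n) → x ≈ 0#
  𝔭^∞⇒0 x h with val x in vx
  ... | nothing = val-∞⇒0 x vx
  ... | just m = ⊥-elim (ℤP.<-irrefl P.refl (ℤP.suc[i]≤j⇒i<j (h (ℤ.suc m) m P.refl)))

  val-nonzero : ∀ x → ¬ (x ≈ 0#) → Σ ℤ λ m → val x ≡ just m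
  val-nonzero x nz with val x in vx
  ... | nothing = ⊥-elim (nz (val-∞⇒0 x vx))
  ... | just m = m , P.refl

  -- val 1 = 0, since val 1 = val (1 * 1) = 2 val 1.
  val-1 : val 1# ≡ just (+ 0)
  val-1 with val-nonzero 1# (λ e → 0≉1 (sym e))
  ... | m , v1 = P.trans v1 (P.cong just (P.sym (ℤ+-cancelˡ m (+ 0) m m+0≡m+m)))
    where
    m+0≡m+m : m ℤ.+ + 0 ≡ m ℤ.+ m
    m+0≡m+m = P.trans (ℤP.+-identityʳ m) (just-injective
      (P.trans (P.sym v1) (P.trans (val-cong (sym (*-identityʳ 1#))) (val-mul 1# 1# m m v1 v1))))

  𝔭-* : ∀ {x y m n} → x ∈𝔭^ m → y ∈𝔭^ n → (x * y) ∈𝔭^ (m ℤ.+ n)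
  𝔭-* {x} {y} {m} {n} hx hy k vxy with val x in vx | val y in vy
  ... | nothing | _ = ⊥-elim (nothing≢just (P.trans (P.sym (val-zero x*y≈0)) vxy))
    where
    x*y≈0 : x * y ≈ 0#
    x*y≈0 = trans (*-congʳ (val-∞⇒0 x vx)) (zeroˡ y)
  ... | just _ | nothing = ⊥-elim (nothing≢just (P.trans (P.sym (val-zero x*y≈0)) vxy))
    where
    x*y≈0 : x * y ≈ 0#
    x*y≈0 = trans (*-congˡ (val-∞⇒0 y vy)) (zeroʳ x)
  ... | just a | just b =
    P.subst (m ℤ.+ n ℤ.≤_) (just-injective (P.trans (P.sym (val-mul x y a b vx vy)) vxy))
            (ℤP.+-mono-≤ (hx a P.refl) (hy b P.refl))

  𝔭-cancel : ∀ {x y m k} → val x ≡ just m → (x * y) ∈𝔭^ k → y ∈𝔭^ (k ℤ.- m)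
  𝔭-cancel {x} {y} {m} {k} vx h b vy =
    P.subst (k ℤ.- m ℤ.≤_) (m+b-m≡b m b) (ℤP.+-monoˡ-≤ (ℤ.- m) (h (m ℤ.+ b) (val-mul x y m b vx vy)))
    where
    m+b-m≡b : ∀ m b → m ℤ.+ b ℤ.- m ≡ b
    m+b-m≡b = solve-∀

  -- val (-1) = 0, since (-1)² = 1.
  val-neg1 : val (- 1#) ≡ just (+ 0)
  val-neg1 with val-nonzero (- 1#) -1≉0
    where
    -1≉0 : ¬ (- 1# ≈ 0#)
    -1≉0 e = 0≉1 (trans (sym (trans (*-congʳ e) (zeroˡ _))) -1*-1≈1)
  ... | k , vk = P.trans vk (P.cong just (k+k≡0⇒k≡0 k (just-injective
                   (P.trans (P.sym (val-mul (- 1#) (- 1#) k k vk vk)) (P.trans (val-cong -1*-1≈1) val-1)))))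
    where
    k+k≡0⇒k≡0 : ∀ k → k ℤ.+ k ≡ + 0 → k ≡ + 0
    k+k≡0⇒k≡0 (+ 0) _ = P.refl
    k+k≡0⇒k≡0 (+ ℕ.suc n) ()
    k+k≡0⇒k≡0 ℤ.-[1+ n ] ()

  𝔭-neg : ∀ {x n} → x ∈𝔭^ n → (- x) ∈𝔭^ n
  𝔭-neg {x} {n} h = 𝔭-cong (-1*x≈-x x)
    (P.subst (λ k → (- 1# * x) ∈𝔭^ k) (ℤP.+-identityˡ n) (𝔭-* (val-exact val-neg1) h))

  𝔭-− : ∀ {x y n} → x ∈𝔭^ n → y ∈𝔭^ n → (x + - y) ∈𝔭^ n
  𝔭-− hx hy = 𝔭-+ hx (𝔭-neg hy)

  𝔭-∑ : ∀ {k} {f : Fin k → K} {n} → (∀ i → f i ∈𝔭^ n) → ∑ f ∈𝔭^ n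
  𝔭-∑ {ℕ.zero} {n = n} h = 𝔭-zero n refl
  𝔭-∑ {ℕ.suc k} h = 𝔭-+ (h zero) (𝔭-∑ (λ i → h (suc i)))

  lowerBound : ∀ x → Σ ℕ λ B → x ∈𝔭^ ℤ.- (+ B)
  lowerBound x with val x
  ... | nothing = 0 , λ m e → ⊥-elim (nothing≢just e)
  ... | just k = ℤ.∣ k ∣ , λ m e → P.subst (ℤ.- (+ ℤ.∣ k ∣) ℤ.≤_) (just-injective e) (-∣i∣≤i k)

  -∘+-antitone : ∀ {a b} → a ℕ.≤ b → ℤ.- (+ b) ℤ.≤ ℤ.- (+ a)
  -∘+-antitone le = ℤP.neg-mono-≤ (ℤ.+≤+ le)

  vecLowerBound : ∀ {k} (f : Fin k → K) → Σ ℕ λ B → ∀ i → f i ∈𝔭^ ℤ.- (+ B)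
  vecLowerBound f = uniformBound (λ i B → f i ∈𝔭^ ℤ.- (+ B))
                      (λ i le → 𝔭-mono (-∘+-antitone le)) (λ i → lowerBound (f i))

  matLowerBound : ∀ {k} (f : Fin k → Fin k → K) → Σ ℕ λ B → ∀ i j → f i j ∈𝔭^ ℤ.- (+ B)
  matLowerBound f = uniformBound (λ i B → ∀ j → f i j ∈𝔭^ ℤ.- (+ B))
                      (λ i le h j → 𝔭-mono (-∘+-antitone le) (h j)) (λ i → vecLowerBound (f i))

  module Half (odd : val (1# + 1#) ≡ just (+ 0)) where
    2≉0 : ¬ (1# + 1# ≈ 0#)
    2≉0 2≈0 = nothing≢just (P.trans (P.sym (val-zero 2≈0)) odd)

    ½ : K
    ½ = proj₁ (inverse (1# + 1#) 2≉0)

    2*½≈1 : (1# + 1#) * ½ ≈ 1#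
    2*½≈1 = proj₂ (inverse (1# + 1#) 2≉0)

    ½+½≈1 : ½ + ½ ≈ 1#
    ½+½≈1 = trans (sym (trans (distribʳ ½ 1# 1#) (+-cong (*-identityˡ ½) (*-identityˡ ½)))) 2*½≈1

    𝔭-halve : ∀ {x n} → (1# + 1#) * x ∈𝔭^ n → x ∈𝔭^ n
    𝔭-halve {x} {n} h = P.subst (x ∈𝔭^_) (ℤP.+-identityʳ n) (𝔭-cancel odd h)

    𝔭-½ : ½ ∈𝔭^ + 0
    𝔭-½ = 𝔭-halve (𝔭-cong (sym 2*½≈1) (val-exact val-1))

module LatticeSequence (R : CommutativeRing 0ℓ 0ℓ) (F : IsNALocalField R)
    (π : CommutativeRing.Carrier R) (valπ : IsNALocalField.val F π ≡ just (+ 1))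
    (d : ℕ) (Λ : ℤ → Subset R F d) (LS : IsLatticeSequence R F π Λ) where
  open CommutativeRing R renaming (Carrier to K) hiding (zero)
  open Matrices R
  open Valuation R F
  open IsNALocalField F
  open Equivalence
  open ≈-Reasoning

  isFullLattice : ∀ s → IsFullLattice R F (Λ s)
  isFullLattice = proj₁ LS

  Λ-antitone< : ∀ s t → t ℤ.< s → _⊆_ R F (Λ s) (Λ t)
  Λ-antitone< = proj₁ (proj₂ LS)

  e : ℕ
  e = proj₁ (proj₂ (proj₂ LS))

  1≤e : 1 ℕ.≤ e
  1≤e = proj₁ (proj₂ (proj₂ (proj₂ LS)))

  Λ-period : ∀ s → _≐_ R F (Λ (s ℤ.+ + e)) (scaleSet R F (Λ s) π)
  Λ-period = proj₂ (proj₂ (proj₂ (proj₂ LS)))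

  𝔭-1 : 1# ∈𝔭^ + 0
  𝔭-1 = val-exact val-1

  module _ (s : ℤ) where
    private
      B : M d
      B = proj₁ (isFullLattice s)

      coords : ∀ v → Λ s v ⇔ (Σ (V d) λ x → (∀ i → x i ∈𝔭^ + 0) × v ≈v B ⊛ x)
      coords = proj₂ (proj₂ (isFullLattice s))

    Λ-cong : ∀ {v w} → v ≈v w → Λ s v → Λ s w
    Λ-cong vw hv with to (coords _) hv
    ... | x , xi , ve = from (coords _) (x , xi , ≈v-trans (≈v-sym vw) ve)

    Λ-+ : ∀ {v w} → Λ s v → Λ s w → Λ s (v +v w)
    Λ-+ {v} {w} hv hw with to (coords _) hv | to (coords _) hw
    ... | x , xi , ve | y , yi , we = from (coords _) (x +v y , (λ i → 𝔭-+ (xi i) (yi i)) ,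
          ≈v-trans (λ i → +-cong (ve i) (we i)) (≈v-sym ($-+v B x y)))

    Λ-· : ∀ {v c} → c ∈𝔭^ + 0 → Λ s v → Λ s (v ·v c)
    Λ-· {v} {c} ic hv with to (coords _) hv
    ... | x , xi , ve = from (coords _) (x ·v c , (λ i → 𝔭-* (xi i) ic) ,
          ≈v-trans (λ i → *-congʳ (ve i)) (≈v-sym ($-·v B x c)))

    Λ-neg : ∀ {v} → Λ s v → Λ s (-v v)
    Λ-neg {v} hv = Λ-cong (λ i → trans (*-comm _ _) (-1*x≈-x (v i))) (Λ-· (𝔭-neg 𝔭-1) hv)

    Λ-0 : Λ s 0v
    Λ-0 = from (coords _) (0v , (λ i → 𝔭-zero _ refl) , ≈v-sym ($-0 B))

    Λ-− : ∀ {v w} → Λ s v → Λ s w → Λ s (v +v -v w)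
    Λ-− hv hw = Λ-+ hv (Λ-neg hw)

  Λ-mono : ∀ {s t} → t ℤ.≤ s → ∀ {v} → Λ s v → Λ t v
  Λ-mono {s} {t} le {v} hv with t ℤP.≟ s
  ... | yes P.refl = hv
  ... | no t≢s = Λ-antitone< s t (ℤP.≤∧≢⇒< le t≢s) v hv

  π^_ : ℕ → K
  π^ ℕ.zero = 1#
  π^ (ℕ.suc k) = π^ k * π

  val-π^ : ∀ k → val (π^ k) ≡ just (+ k)
  val-π^ ℕ.zero = val-1
  val-π^ (ℕ.suc k) = P.trans (val-mul (π^ k) π (+ k) (+ 1) (val-π^ k) valπ)
                             (P.cong just (P.trans (P.sym (ℤP.pos-+ k 1)) (P.cong +_ (NP.+-comm k 1))))

  π⁻¹ : K
  π⁻¹ = proj₁ (inverse π λ π≈0 → nothing≢just (P.trans (P.sym (val-zero π≈0)) valπ))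

  π⁻^_ : ℕ → K
  π⁻^ ℕ.zero = 1#
  π⁻^ (ℕ.suc k) = π⁻^ k * π⁻¹

  π^*π⁻^ : ∀ k → π^ k * π⁻^ k ≈ 1#
  π^*π⁻^ ℕ.zero = *-identityʳ 1#
  π^*π⁻^ (ℕ.suc k) = begin
    π^ k * π * (π⁻^ k * π⁻¹)     ≈⟨ interchange (π^ k) π (π⁻^ k) π⁻¹ ⟩
    π^ k * π⁻^ k * (π * π⁻¹)     ≈⟨ *-cong (π^*π⁻^ k) (proj₂ (inverse π _)) ⟩
    1# * 1#                      ≈⟨ *-identityʳ 1# ⟩
    1#                           ∎
    where
    interchange : ∀ a b c f → a * b * (c * f) ≈ a * c * (b * f)
    interchange a b c f = begin
      a * b * (c * f)   ≈⟨ *-assoc a b (c * f) ⟩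
      a * (b * (c * f)) ≈⟨ *-congˡ (trans (sym (*-assoc b c f)) (trans (*-congʳ (*-comm b c)) (*-assoc c b f))) ⟩
      a * (c * (b * f)) ≈⟨ sym (*-assoc a c (b * f)) ⟩
      a * c * (b * f)   ∎

  𝔭-π^ : ∀ k → π^ k ∈𝔭^ + k
  𝔭-π^ k = val-exact (val-π^ k)

  𝔭-π⁻^ : ∀ k → π⁻^ k ∈𝔭^ ℤ.- (+ k)
  𝔭-π⁻^ k = P.subst (π⁻^ k ∈𝔭^_) (ℤP.+-identityˡ _)
              (𝔭-cancel (val-π^ k) (𝔭-cong (sym (π^*π⁻^ k)) 𝔭-1))

  *-cancelʳ-π^ : ∀ k {x y : K} → x * π^ k ≈ y * π^ k → x ≈ y
  *-cancelʳ-π^ k {x} {y} h = begin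
    x                   ≈⟨ sym (unscale x) ⟩
    x * π^ k * π⁻^ k    ≈⟨ *-congʳ h ⟩
    y * π^ k * π⁻^ k    ≈⟨ unscale y ⟩
    y                   ∎
    where
    unscale : ∀ z → z * π^ k * π⁻^ k ≈ z
    unscale z = trans (*-assoc _ _ _) (trans (*-congˡ (π^*π⁻^ k)) (*-identityʳ z))

  private
    shift-suc : ∀ s k → s ℤ.+ + (ℕ.suc k ℕ.* e) ≡ (s ℤ.+ + (k ℕ.* e)) ℤ.+ + e
    shift-suc s k = P.trans (P.cong (λ z → s ℤ.+ z) (ℤP.pos-+ e (k ℕ.* e))) (rearrange s (+ e) (+ (k ℕ.* e)))
      where
      rearrange : ∀ s a b → s ℤ.+ (a ℤ.+ b) ≡ (s ℤ.+ b) ℤ.+ a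
      rearrange = solve-∀

  Λ-shiftUp : ∀ k s {w} → Λ s w → Λ (s ℤ.+ + (k ℕ.* e)) (w ·v π^ k)
  Λ-shiftUp ℕ.zero s {w} hw =
    P.subst (λ t → Λ t (w ·v 1#)) (P.sym (ℤP.+-identityʳ s)) (Λ-cong s (λ i → sym (*-identityʳ _)) hw)
  Λ-shiftUp (ℕ.suc k) s {w} hw = P.subst (λ t → Λ t (w ·v π^ ℕ.suc k)) (P.sym (shift-suc s k))
    (from (Λ-period (s ℤ.+ + (k ℕ.* e)) _) (w ·v π^ k , Λ-shiftUp k s hw , λ i → sym (*-assoc _ _ _)))

  Λ-shiftDown : ∀ k s {v} → Λ (s ℤ.+ + (k ℕ.* e)) v → Σ (V d) λ w → Λ s w × v ≈v w ·v π^ k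
  Λ-shiftDown ℕ.zero s {v} hv = v , P.subst (λ t → Λ t v) (ℤP.+-identityʳ s) hv , λ i → sym (*-identityʳ _)
  Λ-shiftDown (ℕ.suc k) s {v} hv
    with to (Λ-period (s ℤ.+ + (k ℕ.* e)) v) (P.subst (λ t → Λ t v) (shift-suc s k) hv)
  ... | w₁ , hw₁ , v≈w₁π with Λ-shiftDown k s hw₁
  ... | w , hw , w₁≈wπ^k = w , hw , λ i → trans (v≈w₁π i) (trans (*-congʳ (w₁≈wπ^k i)) (*-assoc _ _ _))

  B₀ : M d
  B₀ = proj₁ (isFullLattice (+ 0))

  B₀⁻¹ : M d
  B₀⁻¹ = proj₁ (proj₁ (proj₂ (isFullLattice (+ 0))))

  B₀B₀⁻¹≋I : B₀ ⊙ B₀⁻¹ ≋ I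
  B₀B₀⁻¹≋I = proj₁ (proj₂ (proj₁ (proj₂ (isFullLattice (+ 0)))))

  B₀⁻¹B₀≋I : B₀⁻¹ ⊙ B₀ ≋ I
  B₀⁻¹B₀≋I = proj₂ (proj₂ (proj₁ (proj₂ (isFullLattice (+ 0)))))

  coords₀ : ∀ v → Λ (+ 0) v ⇔ (Σ (V d) λ x → (∀ i → x i ∈𝔭^ + 0) × v ≈v B₀ ⊛ x)
  coords₀ = proj₂ (proj₂ (isFullLattice (+ 0)))

  cB : ℕ
  cB = proj₁ (matLowerBound B₀)

  cB⁻¹ : ℕ
  cB⁻¹ = proj₁ (matLowerBound B₀⁻¹)

  negKe : ℕ → ℤ
  negKe K = ℤ.- (+ (K ℕ.* e))

  Λ₀⇒entries : ∀ {u} → Λ (+ 0) u → ∀ i → u i ∈𝔭^ ℤ.- (+ cB)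
  Λ₀⇒entries {u} hu i with to (coords₀ u) hu
  ... | x , xi , u≈B₀x = 𝔭-cong (sym (u≈B₀x i)) (𝔭-∑ {d} λ j →
        P.subst (B₀ i j * x j ∈𝔭^_) (ℤP.+-identityʳ _) (𝔭-* (proj₂ (matLowerBound B₀) i j) (xi j)))

  Λ⇒entries : ∀ (K k : ℕ) {t v} → negKe K ℤ.+ + (k ℕ.* e) ℤ.≤ t → Λ t v →
              ∀ i → v i ∈𝔭^ (+ k ℤ.- + K) ℤ.- + cB
  Λ⇒entries K k {t} {v} le hv i with Λ-shiftDown k (negKe K) (Λ-mono le hv)
  ... | w , hw , v≈wπ^k = 𝔭-cong (sym (trans (v≈wπ^k i) (*-comm _ _)))
        (P.subst (π^ k * w i ∈𝔭^_) (rearrange (+ k) (+ K) (+ cB)) (𝔭-* (𝔭-π^ k) wi-bound))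
    where
    wπ^K∈Λ₀ : Λ (+ 0) (w ·v π^ K)
    wπ^K∈Λ₀ = P.subst (λ t' → Λ t' (w ·v π^ K)) (ℤP.+-inverseˡ (+ (K ℕ.* e))) (Λ-shiftUp K (negKe K) hw)
    wi-bound : w i ∈𝔭^ ℤ.- (+ cB) ℤ.- (+ K)
    wi-bound = 𝔭-cancel (val-π^ K) (𝔭-cong (*-comm _ _) (Λ₀⇒entries wπ^K∈Λ₀ i))
    rearrange : ∀ a b c → a ℤ.+ (ℤ.- c ℤ.- b) ≡ a ℤ.- b ℤ.- c
    rearrange = solve-∀

  entries⇒Λ : ∀ (k : ℕ) {v} → (∀ i → v i ∈𝔭^ + k ℤ.+ + cB⁻¹) → Λ (+ (k ℕ.* e)) v
  entries⇒Λ k {v} hv = Λ-cong (+ (k ℕ.* e)) B₀x'π^k≈v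
      (Λ-shiftUp k (+ 0) (from (coords₀ _) (x' , x'-integral , ≈v-refl)))
    where
    x : V d
    x = B₀⁻¹ ⊛ v
    x-bound : ∀ i → x i ∈𝔭^ + k
    x-bound i = 𝔭-∑ {d} λ j → P.subst (B₀⁻¹ i j * v j ∈𝔭^_) (cancel (+ k) (+ cB⁻¹))
                  (𝔭-* (proj₂ (matLowerBound B₀⁻¹) i j) (hv j))
      where cancel : ∀ a c → ℤ.- c ℤ.+ (a ℤ.+ c) ≡ a
            cancel = solve-∀
    x' : V d
    x' = x ·v π⁻^ k
    x'-integral : ∀ i → x' i ∈𝔭^ + 0
    x'-integral i = P.subst (x' i ∈𝔭^_) (ℤP.+-inverseʳ (+ k)) (𝔭-* (x-bound i) (𝔭-π⁻^ k))
    B₀x'π^k≈v : (B₀ ⊛ x') ·v π^ k ≈v v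
    B₀x'π^k≈v = ≈v-trans (≈v-sym ($-·v B₀ x' (π^ k)))
      (≈v-trans ($-congʳ B₀ (λ i → trans (*-assoc _ _ _) (trans (*-congˡ (trans (*-comm _ _) (π^*π⁻^ k))) (*-identityʳ _))))
        (inverse-action B₀B₀⁻¹≋I v))

  -- Λ exhausts V: v π^k ∈ Λ_0 for k large, hence v ∈ Λ_{-ke}.
  Λ-exhaustive : ∀ v → Σ ℕ λ K → Λ (negKe K) v
  Λ-exhaustive v = k , Λ-cong (negKe k) (λ i → *-cancelʳ-π^ k (sym (vπ^k≈wπ^k i))) (proj₁ (proj₂ shifted))
    where
    Bv : ℕ
    Bv = proj₁ (vecLowerBound v)
    k : ℕ
    k = Bv ℕ.+ cB⁻¹
    vπ^k∈Λ₀ : Λ (+ (0 ℕ.* e)) (v ·v π^ k)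
    vπ^k∈Λ₀ = entries⇒Λ 0 λ i → P.subst (v i * π^ k ∈𝔭^_) (cancel (+ Bv) (+ cB⁻¹))
                (𝔭-* (proj₂ (vecLowerBound v) i) (𝔭-π^ k))
      where cancel : ∀ a c → ℤ.- a ℤ.+ (a ℤ.+ c) ≡ + 0 ℤ.+ c
            cancel = solve-∀
    shifted : Σ (V d) λ w → Λ (negKe k) w × v ·v π^ k ≈v w ·v π^ k
    shifted = Λ-shiftDown k (negKe k)
                (P.subst (λ t → Λ t (v ·v π^ k)) (P.sym (ℤP.+-inverseˡ (+ (k ℕ.* e)))) vπ^k∈Λ₀)
    vπ^k≈wπ^k : v ·v π^ k ≈v proj₁ shifted ·v π^ k
    vπ^k≈wπ^k = proj₂ (proj₂ shifted)

  A : ℤ → M d → Set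
  A m x = InA R F Λ m x

  A-cong : ∀ {m x y} → x ≋ y → A m x → A m y
  A-cong {m} x≋y hx s v hv = Λ-cong (s ℤ.+ m) ($-cong x≋y ≈v-refl) (hx s v hv)

  A-mono : ∀ {m m' x} → m' ℤ.≤ m → A m x → A m' x
  A-mono le hx s v hv = Λ-mono (ℤP.+-monoʳ-≤ s le) (hx s v hv)

  A-⊕ : ∀ {m x y} → A m x → A m y → A m (x ⊕ y)
  A-⊕ {m} {x} {y} hx hy s v hv = Λ-cong (s ℤ.+ m) (≈v-sym ($-⊕ x y v)) (Λ-+ (s ℤ.+ m) (hx s v hv) (hy s v hv))

  A-⊖ : ∀ {m x y} → A m x → A m y → A m (x ⊖ y)
  A-⊖ {m} {x} {y} hx hy s v hv = Λ-cong (s ℤ.+ m) (≈v-sym ($-⊖ x y v)) (Λ-− (s ℤ.+ m) (hx s v hv) (hy s v hv))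

  A-⋆ : ∀ {m c x} → c ∈𝔭^ + 0 → A m x → A m (c ⋆ x)
  A-⋆ {m} {c} {x} ic hx s v hv = Λ-cong (s ℤ.+ m) (≈v-sym ($-⋆ c x v)) (Λ-· (s ℤ.+ m) ic (hx s v hv))

  A-⊙ : ∀ {m n x y} → A m x → A n y → A (m ℤ.+ n) (x ⊙ y)
  A-⊙ {m} {n} {x} {y} hx hy s v hv =
    Λ-cong (s ℤ.+ (m ℤ.+ n)) (≈v-sym ($-⊙ x y v))
      (P.subst (λ t → Λ t (x ⊛ (y ⊛ v))) (reassoc s m n) (hx (s ℤ.+ n) (y ⊛ v) (hy s v hv)))
    where reassoc : ∀ s m n → s ℤ.+ n ℤ.+ m ≡ s ℤ.+ (m ℤ.+ n)
          reassoc = solve-∀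

  A-I : A (+ 0) I
  A-I s v hv = Λ-cong (s ℤ.+ + 0) (≈v-sym ($-I v)) (P.subst (λ t → Λ t v) (P.sym (ℤP.+-identityʳ s)) hv)

  A-O : ∀ {m} → A m O
  A-O {m} s v hv = Λ-cong (s ℤ.+ m) (≈v-sym ($-O v)) (Λ-0 (s ℤ.+ m))

  k≤ke : ∀ k → k ℕ.≤ k ℕ.* e
  k≤ke k = NP.≤-trans (NP.≤-reflexive (P.sym (NP.*-identityʳ k))) (NP.*-monoʳ-≤ k 1≤e)

  basis-in-Λ : Σ ℕ λ K₀ → ∀ j → Λ (negKe K₀) (unit j)
  basis-in-Λ = uniformBound (λ j K → Λ (negKe K) (unit j))
                 (λ j le h → Λ-mono (-∘+-antitone (NP.*-monoˡ-≤ e le)) h) (λ j → Λ-exhaustive (unit j))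

  K₀ : ℕ
  K₀ = proj₁ basis-in-Λ

  A⇒entries : ∀ (k : ℕ) {m x} → + (k ℕ.* e) ℤ.≤ m → A m x →
              ∀ i j → x i j ∈𝔭^ (+ k ℤ.- + K₀) ℤ.- + cB
  A⇒entries k {m} {x} le hx i j = 𝔭-cong ($-unit x j i)
    (Λ⇒entries K₀ k (ℤP.+-monoʳ-≤ (negKe K₀) le) (hx (negKe K₀) (unit j) (proj₂ basis-in-Λ j)) i)

  entryIndex : ℕ → ℕ
  entryIndex N = N ℕ.+ K₀ ℕ.+ cB

  entryIndex-bound : ∀ N → (+ entryIndex N ℤ.- + K₀) ℤ.- + cB ≡ + N
  entryIndex-bound N = P.trans (P.cong (λ z → (z ℤ.- + K₀) ℤ.- + cB)
      (P.trans (ℤP.pos-+ (N ℕ.+ K₀) cB) (P.cong (λ z → z ℤ.+ + cB) (ℤP.pos-+ N K₀))))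
    (cancel (+ N) (+ K₀) (+ cB))
    where cancel : ∀ a b c → a ℤ.+ b ℤ.+ c ℤ.- b ℤ.- c ≡ a
          cancel = solve-∀

  A-separated : ∀ {x} → (∀ m → A m x) → x ≋ O
  A-separated {x} h i j = 𝔭^∞⇒0 (x i j) λ n → 𝔭-mono (bound n)
      (A⇒entries (k n) ℤP.≤-refl (h (+ (k n ℕ.* e))) i j)
    where
    k : ℤ → ℕ
    k n = entryIndex ℤ.∣ n ∣
    bound : ∀ n → n ℤ.≤ (+ k n ℤ.- + K₀) ℤ.- + cB
    bound n = ℤP.≤-trans (i≤∣i∣ n) (ℤP.≤-reflexive (P.sym (entryIndex-bound ℤ.∣ n ∣)))

  smallEntries⇒maps : ∀ t m → Σ ℤ λ N → ∀ x v → (∀ i j → x i j ∈𝔭^ N) → Λ t v → Λ (t ℤ.+ m) (x ⊛ v)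
  smallEntries⇒maps t m = N , λ x v hx hv → Λ-mono (t+m≤k'e) (entries⇒Λ k' λ i →
      P.subst ((x ⊛ v) i ∈𝔭^_) (cancel (+ k') (+ cB⁻¹) (+ kt) (+ cB))
        (𝔭-∑ {d} λ j → 𝔭-* (hx i j) (Λ⇒entries kt 0 negKe≤t hv j)))
    where
    kt k' : ℕ
    kt = ℤ.∣ t ∣
    k' = ℤ.∣ t ℤ.+ m ∣
    N : ℤ
    N = (+ k' ℤ.+ + cB⁻¹) ℤ.+ (+ kt ℤ.+ + cB)
    cancel : ∀ a b c f → (a ℤ.+ b) ℤ.+ (c ℤ.+ f) ℤ.+ ((+ 0 ℤ.- c) ℤ.- f) ≡ a ℤ.+ b
    cancel = solve-∀
    negKe≤t : negKe kt ℤ.+ + (0 ℕ.* e) ℤ.≤ t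
    negKe≤t = ℤP.≤-trans (ℤP.≤-reflexive (ℤP.+-identityʳ _))
                (ℤP.≤-trans (-∘+-antitone (k≤ke kt)) (-∣i∣≤i t))
    t+m≤k'e : t ℤ.+ m ℤ.≤ + (k' ℕ.* e)
    t+m≤k'e = ℤP.≤-trans (i≤∣i∣ (t ℤ.+ m)) (ℤ.+≤+ (k≤ke k'))

  -- Completeness of M_d(F) for the filtration: a sequence G with
  -- G n - G N ∈ a_{rate N}(Λ) for n ≥ N, where rate N ≥ N, converges
  -- (entrywise, by completeness of F) to a limit with the same property.
  module Completeness (G : ℕ → M d) (rate : ℕ → ℤ) (N≤rate : ∀ N → + N ℤ.≤ rate N)
                      (cauchy : ∀ N n → N ℕ.≤ n → A (rate N) (G n ⊖ G N)) where

    entries-cauchy : ∀ N → Σ ℕ λ M₀ → ∀ m n → M₀ ℕ.≤ m → M₀ ℕ.≤ n →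
                     ∀ i j → G m i j + - G n i j ∈𝔭^ + N
    entries-cauchy N = M₀ , λ m n M₀≤m M₀≤n i j →
        𝔭-cong (sym (x-y≈[x-z]-[y-z] _ _ _)) (𝔭-− (close m M₀≤m i j) (close n M₀≤n i j))
      where
      M₀ : ℕ
      M₀ = entryIndex N ℕ.* e
      close : ∀ m → M₀ ℕ.≤ m → ∀ i j → G m i j + - G M₀ i j ∈𝔭^ + N
      close m M₀≤m i j = P.subst (G m i j + - G M₀ i j ∈𝔭^_) (entryIndex-bound N)
        (A⇒entries (entryIndex N) (N≤rate M₀) (cauchy M₀ m M₀≤m) i j)

    entry-limit : ∀ i j → Σ K λ L → ∀ N → Σ ℕ λ M₀ → ∀ n → M₀ ℕ.≤ n → G n i j + - L ∈𝔭^ + N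
    entry-limit i j = complete (λ n → G n i j)
      (λ N → proj₁ (entries-cauchy N) , λ m n M₀≤m M₀≤n → proj₂ (entries-cauchy N) m n M₀≤m M₀≤n i j)

    limit : M d
    limit i j = proj₁ (entry-limit i j)

    converges : ∀ N → Σ ℕ λ M₀ → ∀ n → M₀ ℕ.≤ n → ∀ i j → G n i j + - limit i j ∈𝔭^ + N
    converges N = proj₁ all , λ n le i j → proj₂ all i n le j
      where
      row : ∀ i → Σ ℕ λ M₀ → ∀ n → M₀ ℕ.≤ n → ∀ j → G n i j + - limit i j ∈𝔭^ + N
      row i = proj₁ r , λ n le j → proj₂ r j n le
        where r = eventuallyAll (λ j n → G n i j + - limit i j ∈𝔭^ + N) (λ j → proj₂ (entry-limit i j) N)
      all : Σ ℕ λ M₀ → ∀ i n → M₀ ℕ.≤ n → ∀ j → G n i j + - limit i j ∈𝔭^ + N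
      all = eventuallyAll (λ i n → ∀ j → G n i j + - limit i j ∈𝔭^ + N) row

    -- limit - G N = (limit - G n) + (G n - G N) for n large: the first term
    -- has small entries, the second lies in a_{rate N}(Λ).
    limit-close : ∀ N → A (rate N) (limit ⊖ G N)
    limit-close N s v hv = Λ-cong (s ℤ.+ rate N)
        (≈v-sym (≈v-trans ($-cong split ≈v-refl) ($-⊕ (limit ⊖ G n) (G n ⊖ G N) v)))
        (Λ-+ (s ℤ.+ rate N) (proj₂ (smallEntries⇒maps s (rate N)) (limit ⊖ G n) v small hv)
                            (cauchy N n (NP.m≤n⊔m M₀ N) s v hv))
      where
      bound : ℤ
      bound = proj₁ (smallEntries⇒maps s (rate N))
      M₀ n : ℕ
      M₀ = proj₁ (converges ℤ.∣ bound ∣)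
      n = M₀ ℕ.⊔ N
      small : ∀ i j → (limit ⊖ G n) i j ∈𝔭^ bound
      small i j = 𝔭-mono (i≤∣i∣ bound) (𝔭-cong (sym (x-y≈-[y-x] _ _))
                    (𝔭-neg (proj₂ (converges ℤ.∣ bound ∣) n (NP.m≤m⊔n M₀ N) i j)))
      split : limit ⊖ G N ≋ (limit ⊖ G n) ⊕ (G n ⊖ G N)
      split i j = x-y≈[x-z]+[z-y] _ _ _

  Λ-separated : ∀ {v} → (∀ k → Λ (+ k) v) → ∀ i → v i ≈ 0#
  Λ-separated {v} hv i = 𝔭^∞⇒0 (v i) λ n → 𝔭-mono (bound n)
      (Λ⇒entries 0 (k n) (ℤP.≤-reflexive (ℤP.+-identityˡ _)) (hv (k n ℕ.* e)) i)
    where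
    k : ℤ → ℕ
    k n = ℤ.∣ n ∣ ℕ.+ cB
    bound : ∀ n → n ℤ.≤ (+ k n ℤ.- + 0) ℤ.- + cB
    bound n = ℤP.≤-trans (i≤∣i∣ n) (ℤP.≤-reflexive (P.trans (cancel (+ ℤ.∣ n ∣) (+ cB))
                (P.cong (λ z → (z ℤ.- + 0) ℤ.- + cB) (P.sym (ℤP.pos-+ ℤ.∣ n ∣ cB)))))
      where cancel : ∀ a c → a ≡ ((a ℤ.+ c) ℤ.- + 0) ℤ.- c
            cancel = solve-∀

  -- If V ≠ 0, then Λ_0 ≠ 0: the basis vector B₀ e_j lies in Λ_0 and is nonzero.
  Λ₀-nontrivial : Fin d → ¬ (∀ v → Λ (+ 0) v → ∀ i → v i ≈ 0#)
  Λ₀-nontrivial j Λ₀≡0 = 0≉1 (begin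
    0#                                   ≈⟨ sym (∑-0 {d}) ⟩
    ∑ {d} (λ _ → 0#)                     ≈⟨ ∑-cong {d} (λ k → sym (zeroʳ (B₀⁻¹ j k))) ⟩
    ∑ (λ k → B₀⁻¹ j k * 0#)              ≈⟨ ∑-cong {d} (λ k → *-congˡ (sym (Λ₀≡0 (B₀ ⊛ unit j) B₀e∈Λ₀ k))) ⟩
    (B₀⁻¹ ⊛ (B₀ ⊛ unit j)) j              ≈⟨ inverse-action B₀⁻¹B₀≋I (unit j) j ⟩
    δ j j                                ≈⟨ δ-refl j ⟩
    1#                                   ∎)
    where
    B₀e∈Λ₀ : Λ (+ 0) (B₀ ⊛ unit j)
    B₀e∈Λ₀ = from (coords₀ _) (unit j , (λ i → δ-integral i j) , ≈v-refl)
      where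
      δ-integral : ∀ i j → δ i j ∈𝔭^ + 0
      δ-integral i j with i ≟ j
      ... | yes _ = 𝔭-1
      ... | no _  = 𝔭-zero _ refl

module HermitianForm (R : CommutativeRing 0ℓ 0ℓ)
    (ρ : CommutativeRing.Carrier R → CommutativeRing.Carrier R) (ρA : IsAutOrderLe2 R ρ)
    (ε : CommutativeRing.Carrier R) {d : ℕ} (h : Form R d) (H : IsNondegEpsHermitian R ρ ε h) where
  open CommutativeRing R renaming (Carrier to K) hiding (zero)
  open Matrices R
  open IsAutOrderLe2 ρA
  open IsNondegEpsHermitian H
  open ≈-Reasoning

  ρ-0 : ρ 0# ≈ 0#
  ρ-0 = identityˡ-unique (ρ 0#) (ρ 0#) (trans (sym (ρ-+ 0# 0#)) (ρ-cong (+-identityʳ 0#)))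

  h-εherm : ∀ v u → h v u ≈ ε * ρ (h u v)
  h-εherm v u = begin
    h v u                     ≈⟨ h-cong (λ i → sym (*-identityʳ (v i))) (λ i → sym (*-identityʳ (u i))) ⟩
    h (v ·v 1#) (u ·v 1#)     ≈⟨ h-herm v u 1# 1# ⟩
    ρ 1# * ε * ρ (h u v) * 1# ≈⟨ trans (*-identityʳ _) (*-congʳ (trans (*-congʳ ρ-1) (*-identityˡ ε))) ⟩
    ε * ρ (h u v)             ∎

  h-scalˡ : ∀ v u c → h (v ·v c) u ≈ ρ c * h v u
  h-scalˡ v u c = begin
    h (v ·v c) u              ≈⟨ h-cong (λ i → refl) (λ i → sym (*-identityʳ (u i))) ⟩
    h (v ·v c) (u ·v 1#)      ≈⟨ h-herm v u c 1# ⟩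
    ρ c * ε * ρ (h u v) * 1#  ≈⟨ trans (*-identityʳ _) (*-assoc _ _ _) ⟩
    ρ c * (ε * ρ (h u v))     ≈⟨ *-congˡ (sym (h-εherm v u)) ⟩
    ρ c * h v u               ∎

  h-scalʳ : ∀ v u c → h v (u ·v c) ≈ h v u * c
  h-scalʳ v u c = begin
    h v (u ·v c)              ≈⟨ h-cong (λ i → sym (*-identityʳ (v i))) (λ i → refl) ⟩
    h (v ·v 1#) (u ·v c)      ≈⟨ h-herm v u 1# c ⟩
    ρ 1# * ε * ρ (h u v) * c  ≈⟨ *-congʳ (trans (*-congʳ (trans (*-congʳ ρ-1) (*-identityˡ ε))) (sym (h-εherm v u))) ⟩
    h v u * c                 ∎

  h-0ˡ : ∀ u → h 0v u ≈ 0#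
  h-0ˡ u = trans (h-cong (λ i → sym (zeroʳ 0#)) (λ i → refl))
                 (trans (h-scalˡ 0v u 0#) (trans (*-congʳ ρ-0) (zeroˡ _)))
  h-0ʳ : ∀ v → h v 0v ≈ 0#
  h-0ʳ v = trans (h-cong (λ i → refl) (λ i → sym (zeroʳ 0#))) (trans (h-scalʳ v 0v 0#) (zeroʳ _))

  h-negˡ : ∀ v u → h (-v v) u ≈ - h v u
  h-negˡ v u = inverseʳ-unique (h v u) (h (-v v) u)
    (trans (sym (h-+ˡ v (-v v) u)) (trans (h-cong (λ i → -‿inverseʳ (v i)) (λ i → refl)) (h-0ˡ u)))
  h-negʳ : ∀ v u → h v (-v u) ≈ - h v u
  h-negʳ v u = inverseʳ-unique (h v u) (h v (-v u))
    (trans (sym (h-+ʳ v u (-v u))) (trans (h-cong (λ i → refl) (λ i → -‿inverseʳ (u i))) (h-0ʳ v)))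

  h-⊖ʳ : ∀ (x x' : M d) v u → h v ((x ⊖ x') ⊛ u) ≈ h v (x ⊛ u) + - h v (x' ⊛ u)
  h-⊖ʳ x x' v u = trans (h-cong (λ i → refl) ($-⊖ x x' u)) (trans (h-+ʳ _ _ _) (+-congˡ (h-negʳ _ _)))

-- Duality makes h
-- continuous for the filtration: if x ∈ a_m(Λ) with m large, then h(xv, w)
-- and h(v, xw) are divisible by a prescribed power of π.
module Duality (R : CommutativeRing 0ℓ 0ℓ) (F : IsNALocalField R)
    (π : CommutativeRing.Carrier R) (valπ : IsNALocalField.val F π ≡ just (+ 1))
    (d : ℕ) (Λ : ℤ → Subset R F d) (LS : IsLatticeSequence R F π Λ)
    (ρ : CommutativeRing.Carrier R → CommutativeRing.Carrier R) (ρA : IsAutOrderLe2 R ρ)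
    (ρπ : CommutativeRing._≈_ R (ρ π) π ⊎ CommutativeRing._≈_ R (ρ π) (CommutativeRing.-_ R π))
    (ε : CommutativeRing.Carrier R) (h : Form R d) (H : IsNondegEpsHermitian R ρ ε h)
    (SD : IsSelfDual R F h Λ) where
  open CommutativeRing R renaming (Carrier to K) hiding (zero)
  open Matrices R
  open Valuation R F
  open LatticeSequence R F π valπ d Λ LS
  open HermitianForm R ρ ρA ε h H
  open IsAutOrderLe2 ρA
  open IsNondegEpsHermitian H
  open Equivalence

  u : ℤ
  u = proj₁ SD

  dualityˡ : ∀ r {v w} → Λ r v → Λ (u ℤ.- r) w → h v w ∈𝔭^ + 1
  dualityˡ r {v} {w} hv hw =
    from (proj₂ SD (u ℤ.- r) v) (P.subst (λ t → Λ t v) (P.sym (u-[u-r]≡r u r)) hv) w hw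
    where u-[u-r]≡r : ∀ a b → a ℤ.- (a ℤ.- b) ≡ b
          u-[u-r]≡r = solve-∀
  dualityʳ : ∀ r {v w} → Λ (u ℤ.- r) v → Λ r w → h v w ∈𝔭^ + 1
  dualityʳ r {v} {w} hv hw = from (proj₂ SD r v) hv w hw

  𝔭-ρπ : ρ π ∈𝔭^ + 1
  𝔭-ρπ = bound ρπ
    where
    bound : (ρ π ≈ π) ⊎ (ρ π ≈ - π) → ρ π ∈𝔭^ + 1
    bound (inj₁ ρπ≈π) = 𝔭-cong (sym ρπ≈π) (val-exact valπ)
    bound (inj₂ ρπ≈-π) = 𝔭-cong (sym ρπ≈-π) (𝔭-neg (val-exact valπ))

  𝔭-ρπ^ : ∀ k → ρ (π^ k) ∈𝔭^ + k
  𝔭-ρπ^ ℕ.zero = 𝔭-cong (sym ρ-1) 𝔭-1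
  𝔭-ρπ^ (ℕ.suc k) = 𝔭-cong (sym (ρ-* (π^ k) π))
    (P.subst (ρ (π^ k) * ρ π ∈𝔭^_) (P.trans (P.sym (ℤP.pos-+ k 1)) (P.cong +_ (NP.+-comm k 1)))
      (𝔭-* (𝔭-ρπ^ k) 𝔭-ρπ))

  level : V d → ℤ
  level v = negKe (proj₁ (Λ-exhaustive v))
  in-level : ∀ v → Λ (level v) v
  in-level v = proj₂ (Λ-exhaustive v)

  continuityIndex : V d → V d → ℕ → ℤ
  continuityIndex v w K = ((u ℤ.- level v) ℤ.- level w) ℤ.+ + (K ℕ.* e)

  private
    split-index : ∀ t m k → t ℤ.+ m ≡ (t ℤ.+ m ℤ.- k) ℤ.+ k
    split-index = solve-∀
    dual-index : ∀ u t t' m k → u ℤ.- (t ℤ.+ m ℤ.- k) ≡ t' ℤ.+ ((((u ℤ.- t) ℤ.- t') ℤ.+ k) ℤ.- m)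
    dual-index = solve-∀
    dual-index' : ∀ u t t' m k → u ℤ.- (t' ℤ.+ m ℤ.- k) ≡ t ℤ.+ ((((u ℤ.- t) ℤ.- t') ℤ.+ k) ℤ.- m)
    dual-index' = solve-∀
    below : ∀ {m₀ m} c → m₀ ℤ.≤ m → c ℤ.+ (m₀ ℤ.- m) ℤ.≤ c
    below c le = ℤP.≤-trans (ℤP.+-monoʳ-≤ c (ℤP.i≤j⇒i-j≤0 le)) (ℤP.≤-reflexive (ℤP.+-identityʳ c))

  -- Write xv = y π^K with y ∈ Λ_r; then w ∈ Λ_{u-r}, so h(xv, w) = ρ(π^K) h(y, w).
  h-continuousˡ : ∀ v w K m x → continuityIndex v w K ℤ.≤ m → A m x → h (x ⊛ v) w ∈𝔭^ + K
  h-continuousˡ v w K m x le hx =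
    𝔭-cong (sym (trans (h-cong xv≈yπ^K (λ i → refl)) (h-scalˡ y w (π^ K))))
      (𝔭-mono (ℤP.i≤i+j (+ K) (+ 1)) (𝔭-* (𝔭-ρπ^ K) (dualityˡ r y∈Λr w∈Λu-r)))
    where
    r : ℤ
    r = level v ℤ.+ m ℤ.- + (K ℕ.* e)
    shifted : Σ (V d) λ y → Λ r y × x ⊛ v ≈v y ·v π^ K
    shifted = Λ-shiftDown K r (P.subst (λ t → Λ t (x ⊛ v)) (split-index (level v) m (+ (K ℕ.* e)))
                                        (hx (level v) v (in-level v)))
    y : V d
    y = proj₁ shifted
    y∈Λr : Λ r y
    y∈Λr = proj₁ (proj₂ shifted)
    xv≈yπ^K : x ⊛ v ≈v y ·v π^ K
    xv≈yπ^K = proj₂ (proj₂ shifted)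
    w∈Λu-r : Λ (u ℤ.- r) w
    w∈Λu-r = Λ-mono (P.subst (ℤ._≤ level w) (P.sym (dual-index u (level v) (level w) m (+ (K ℕ.* e))))
                              (below (level w) le)) (in-level w)

  h-continuousʳ : ∀ v w K m x → continuityIndex v w K ℤ.≤ m → A m x → h v (x ⊛ w) ∈𝔭^ + K
  h-continuousʳ v w K m x le hx =
    𝔭-cong (sym (trans (h-cong (λ i → refl) xw≈yπ^K) (h-scalʳ v y (π^ K))))
      (𝔭-cong (*-comm _ _) (𝔭-mono (ℤP.i≤i+j (+ K) (+ 1)) (𝔭-* (𝔭-π^ K) (dualityʳ r v∈Λu-r y∈Λr))))
    where
    r : ℤ
    r = level w ℤ.+ m ℤ.- + (K ℕ.* e)
    shifted : Σ (V d) λ y → Λ r y × x ⊛ w ≈v y ·v π^ K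
    shifted = Λ-shiftDown K r (P.subst (λ t → Λ t (x ⊛ w)) (split-index (level w) m (+ (K ℕ.* e)))
                                        (hx (level w) w (in-level w)))
    y : V d
    y = proj₁ shifted
    y∈Λr : Λ r y
    y∈Λr = proj₁ (proj₂ shifted)
    xw≈yπ^K : x ⊛ w ≈v y ·v π^ K
    xw≈yπ^K = proj₂ (proj₂ shifted)
    v∈Λu-r : Λ (u ℤ.- r) v
    v∈Λu-r = Λ-mono (P.subst (ℤ._≤ level v) (P.sym (dual-index' u (level v) (level w) m (+ (K ℕ.* e))))
                              (below (level v) le)) (in-level v)

module SelfAdjoint (R : CommutativeRing 0ℓ 0ℓ)
    (ρ : CommutativeRing.Carrier R → CommutativeRing.Carrier R) (ρA : IsAutOrderLe2 R ρ)
    (ε : CommutativeRing.Carrier R) {d : ℕ} (h : Form R d) (H : IsNondegEpsHermitian R ρ ε h)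
    (a : Mat R d) where
  open CommutativeRing R renaming (Carrier to K) hiding (zero)
  open Matrices R
  open HermitianForm R ρ ρA ε h H
  open IsNondegEpsHermitian H
  open ≈-Reasoning

  b : V d → V d → K
  b v w = h (a ⊛ v) w

  IsSelfAdjoint : M d → Set
  IsSelfAdjoint x = ∀ v w → b (x ⊛ v) w ≈ b v (x ⊛ w)

  b-⊖ˡ : ∀ x x' v w → b ((x ⊖ x') ⊛ v) w ≈ b (x ⊛ v) w + - b (x' ⊛ v) w
  b-⊖ˡ x x' v w = begin
    h (a ⊛ ((x ⊖ x') ⊛ v)) w                        ≈⟨ h-cong ($-congʳ a ($-⊖ x x' v)) (λ i → refl) ⟩
    h (a ⊛ (x ⊛ v +v -v (x' ⊛ v))) w                ≈⟨ h-cong ($-+v a (x ⊛ v) (-v (x' ⊛ v))) (λ i → refl) ⟩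
    h (a ⊛ (x ⊛ v) +v a ⊛ (-v (x' ⊛ v))) w          ≈⟨ h-+ˡ _ _ w ⟩
    b (x ⊛ v) w + h (a ⊛ (-v (x' ⊛ v))) w           ≈⟨ +-congˡ (h-cong ($--v a (x' ⊛ v)) (λ i → refl)) ⟩
    b (x ⊛ v) w + h (-v (a ⊛ (x' ⊛ v))) w           ≈⟨ +-congˡ (h-negˡ _ w) ⟩
    b (x ⊛ v) w + - b (x' ⊛ v) w                    ∎

  b-⊖ʳ : ∀ x x' v w → b v ((x ⊖ x') ⊛ w) ≈ b v (x ⊛ w) + - b v (x' ⊛ w)
  b-⊖ʳ x x' v w = h-⊖ʳ x x' (a ⊛ v) w

  selfAdjoint-I : IsSelfAdjoint I
  selfAdjoint-I v w = trans (h-cong ($-congʳ a ($-I v)) (λ i → refl)) (h-cong (λ i → refl) (≈v-sym ($-I w)))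

  selfAdjoint-⊖ : ∀ {x x'} → IsSelfAdjoint x → IsSelfAdjoint x' → IsSelfAdjoint (x ⊖ x')
  selfAdjoint-⊖ {x} {x'} sx sx' v w =
    trans (b-⊖ˡ x x' v w) (trans (+-cong (sx v w) (-‿cong (sx' v w))) (sym (b-⊖ʳ x x' v w)))

  selfAdjoint-⋆ : ∀ {c x} → ρ c ≈ c → IsSelfAdjoint x → IsSelfAdjoint (c ⋆ x)
  selfAdjoint-⋆ {c} {x} ρc≈c sx v w = begin
    h (a ⊛ ((c ⋆ x) ⊛ v)) w     ≈⟨ h-cong (≈v-trans ($-congʳ a ($-⋆ c x v)) ($-·v a (x ⊛ v) c)) (λ i → refl) ⟩
    h ((a ⊛ (x ⊛ v)) ·v c) w    ≈⟨ h-scalˡ _ w c ⟩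
    ρ c * b (x ⊛ v) w           ≈⟨ *-cong ρc≈c (sx v w) ⟩
    c * b v (x ⊛ w)             ≈⟨ *-comm _ _ ⟩
    b v (x ⊛ w) * c             ≈⟨ sym (h-scalʳ _ _ c) ⟩
    h (a ⊛ v) ((x ⊛ w) ·v c)    ≈⟨ h-cong (λ i → refl) (≈v-sym ($-⋆ c x w)) ⟩
    b v ((c ⋆ x) ⊛ w)           ∎

  selfAdjoint-² : ∀ {x} → IsSelfAdjoint x → IsSelfAdjoint (x ⊙ x)
  selfAdjoint-² {x} sx v w = begin
    h (a ⊛ ((x ⊙ x) ⊛ v)) w     ≈⟨ h-cong ($-congʳ a ($-⊙ x x v)) (λ i → refl) ⟩
    b (x ⊛ (x ⊛ v)) w           ≈⟨ sx _ w ⟩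
    b (x ⊛ v) (x ⊛ w)           ≈⟨ sx v _ ⟩
    b v (x ⊛ (x ⊛ w))           ≈⟨ h-cong (λ i → refl) (≈v-sym ($-⊙ x x w)) ⟩
    b v ((x ⊙ x) ⊛ w)           ∎

-- Starting
-- from G₀ = 1, the iteration G' = G - ½(G² - w) stays in Ũ^s(Λ),
-- commutes with w and stays self-adjoint, while the error G² - w gains s
-- in the filtration at each step.  By completeness it converges to a
-- square root g of w with the same properties; self-adjointness passes to
-- the limit through the continuity of h given by self-duality.
module NewtonSquareRoot (R : CommutativeRing 0ℓ 0ℓ) (F : IsNALocalField R)
    (odd : OddResidualChar R F)
    (π : CommutativeRing.Carrier R) (valπ : IsNALocalField.val F π ≡ just (+ 1))
    (d : ℕ) (Λ : ℤ → Subset R F d) (LS : IsLatticeSequence R F π Λ)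
    (ρ : CommutativeRing.Carrier R → CommutativeRing.Carrier R) (ρA : IsAutOrderLe2 R ρ)
    (ρπ : CommutativeRing._≈_ R (ρ π) π ⊎ CommutativeRing._≈_ R (ρ π) (CommutativeRing.-_ R π))
    (ε : CommutativeRing.Carrier R) (h : Form R d) (H : IsNondegEpsHermitian R ρ ε h)
    (SD : IsSelfDual R F h Λ)
    (s : ℕ) (s>0 : 0 ℕ.< s)
    (a : Mat R d) (n : ℤ) (a∈A : InA R F Λ n a)
    (w : Mat R d) (w∈U : InU R F Λ (+ s) w)
    (w-selfAdjoint : SelfAdjoint.IsSelfAdjoint R ρ ρA ε h H a w) where
  open CommutativeRing R renaming (Carrier to K) hiding (zero)
  open Matrices R
  open Valuation R F
  open Valuation.Half R F odd
  open LatticeSequence R F π valπ d Λ LS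
  open Duality R F π valπ d Λ LS ρ ρA ρπ ε h H SD
  open SelfAdjoint R ρ ρA ε h H a
  open IsAutOrderLe2 ρA
  open IsNondegEpsHermitian H using (h-cong)

  -- ½ is fixed by ρ, since ρ fixes 2.
  ρ-½ : ρ ½ ≈ ½
  ρ-½ = begin
    ρ ½                            ≈⟨ sym (*-identityʳ _) ⟩
    ρ ½ * 1#                       ≈⟨ *-congˡ (sym 2*½≈1) ⟩
    ρ ½ * ((1# + 1#) * ½)          ≈⟨ sym (*-assoc _ _ _) ⟩
    ρ ½ * (1# + 1#) * ½            ≈⟨ *-congʳ (*-congˡ (sym (trans (ρ-+ 1# 1#) (+-cong ρ-1 ρ-1)))) ⟩
    ρ ½ * ρ (1# + 1#) * ½          ≈⟨ *-congʳ (trans (sym (ρ-* ½ (1# + 1#))) (ρ-cong (*-comm ½ _))) ⟩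
    ρ ((1# + 1#) * ½) * ½          ≈⟨ *-congʳ (trans (ρ-cong 2*½≈1) ρ-1) ⟩
    1# * ½                         ≈⟨ *-identityˡ ½ ⟩
    ½                              ∎
    where open ≈-Reasoning

  err : M d → M d
  err G = G ⊙ G ⊖ w

  step : M d → M d
  step G = G ⊖ ½ ⋆ err G

  Commutes : M d → Set
  Commutes G = G ⊙ w ≋ w ⊙ G

  private
    module _ {G : M d} (c : Commutes G) where
      open ≋-Reasoning
      err-commutes-w : err G ⊙ w ≋ w ⊙ err G
      err-commutes-w = begin
        (G ⊙ G ⊖ w) ⊙ w         ≈⟨ ⊙-⊖ʳ (G ⊙ G) w w ⟩
        G ⊙ G ⊙ w ⊖ w ⊙ w       ≈⟨ ⊖-cong square-commutes ≋-refl ⟩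
        w ⊙ (G ⊙ G) ⊖ w ⊙ w     ≈⟨ ≋-sym (⊙-⊖ˡ w (G ⊙ G) w) ⟩
        w ⊙ (G ⊙ G ⊖ w)         ∎
        where
        square-commutes : (G ⊙ G) ⊙ w ≋ w ⊙ (G ⊙ G)
        square-commutes = begin
          (G ⊙ G) ⊙ w   ≈⟨ ⊙-assoc G G w ⟩
          G ⊙ (G ⊙ w)   ≈⟨ ⊙-cong ≋-refl c ⟩
          G ⊙ (w ⊙ G)   ≈⟨ ≋-sym (⊙-assoc G w G) ⟩
          (G ⊙ w) ⊙ G   ≈⟨ ⊙-cong c ≋-refl ⟩
          (w ⊙ G) ⊙ G   ≈⟨ ⊙-assoc w G G ⟩
          w ⊙ (G ⊙ G)   ∎

      err-commutes-G : err G ⊙ G ≋ G ⊙ err G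
      err-commutes-G = begin
        (G ⊙ G ⊖ w) ⊙ G         ≈⟨ ⊙-⊖ʳ (G ⊙ G) w G ⟩
        G ⊙ G ⊙ G ⊖ w ⊙ G       ≈⟨ ⊖-cong (⊙-assoc G G G) (≋-sym c) ⟩
        G ⊙ (G ⊙ G) ⊖ G ⊙ w     ≈⟨ ≋-sym (⊙-⊖ˡ G (G ⊙ G) w) ⟩
        G ⊙ (G ⊙ G ⊖ w)         ∎

  step-commutes : ∀ {G} → Commutes G → Commutes (step G)
  step-commutes {G} c = begin
    (G ⊖ ½ ⋆ err G) ⊙ w         ≈⟨ ⊙-⊖ʳ G (½ ⋆ err G) w ⟩
    G ⊙ w ⊖ (½ ⋆ err G) ⊙ w     ≈⟨ ⊖-cong c (⋆-⊙ˡ ½ (err G) w) ⟩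
    w ⊙ G ⊖ ½ ⋆ (err G ⊙ w)     ≈⟨ ⊖-cong ≋-refl (⋆-cong refl (err-commutes-w c)) ⟩
    w ⊙ G ⊖ ½ ⋆ (w ⊙ err G)     ≈⟨ ⊖-cong ≋-refl (≋-sym (⋆-⊙ʳ ½ w (err G))) ⟩
    w ⊙ G ⊖ w ⊙ (½ ⋆ err G)     ≈⟨ ≋-sym (⊙-⊖ˡ w G (½ ⋆ err G)) ⟩
    w ⊙ (G ⊖ ½ ⋆ err G)         ∎
    where open ≋-Reasoning

  step-err : ∀ {G} → Commutes G → err (step G) ≋ (I ⊖ G) ⊙ err G ⊕ ½ ⋆ (½ ⋆ (err G ⊙ err G))
  step-err {G} c = ≋-trans (⊖-cong expand ≋-refl) (≋-trans collect
                     (≋-sym (⊕-cong (≋-trans (⊙-⊖ʳ I G E) (⊖-cong (⊙-Iˡ E) ≋-refl)) ≋-refl)))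
    where
    E Y : M d
    E = err G
    Y = ½ ⋆ E
    expand : step G ⊙ step G ≋ (G ⊙ G ⊖ ½ ⋆ (G ⊙ E)) ⊖ (½ ⋆ (G ⊙ E) ⊖ ½ ⋆ (½ ⋆ (E ⊙ E)))
    expand = begin
      (G ⊖ Y) ⊙ (G ⊖ Y)                     ≈⟨ ⊙-⊖ʳ G Y (G ⊖ Y) ⟩
      G ⊙ (G ⊖ Y) ⊖ Y ⊙ (G ⊖ Y)             ≈⟨ ⊖-cong (⊙-⊖ˡ G G Y) (⊙-⊖ˡ Y G Y) ⟩
      (G ⊙ G ⊖ G ⊙ Y) ⊖ (Y ⊙ G ⊖ Y ⊙ Y)     ≈⟨ ⊖-cong (⊖-cong ≋-refl (⋆-⊙ʳ ½ G E))
                                                  (⊖-cong (≋-trans (⋆-⊙ˡ ½ E G) (⋆-cong refl (err-commutes-G c)))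
                                                          (≋-trans (⋆-⊙ˡ ½ E Y) (⋆-cong refl (⋆-⊙ʳ ½ E E)))) ⟩
      (G ⊙ G ⊖ ½ ⋆ (G ⊙ E)) ⊖ (½ ⋆ (G ⊙ E) ⊖ ½ ⋆ (½ ⋆ (E ⊙ E)))   ∎
      where open ≋-Reasoning
    collect : (G ⊙ G ⊖ ½ ⋆ (G ⊙ E)) ⊖ (½ ⋆ (G ⊙ E) ⊖ ½ ⋆ (½ ⋆ (E ⊙ E))) ⊖ w ≋
              (E ⊖ G ⊙ E) ⊕ ½ ⋆ (½ ⋆ (E ⊙ E))
    collect i j = halves-collect _ _ _ _
      where
      open ≈-Reasoning
      halves-collect : ∀ p q r t → ((p + - (½ * q)) + - (½ * q + - (½ * r))) + - t ≈ ((p + - t) + - q) + ½ * r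
      halves-collect p q r t = begin
        ((p + - (½ * q)) + - (½ * q + - (½ * r))) + - t  ≈⟨ +-congʳ (+-congˡ (sym (x-y≈-[y-x] (½ * r) (½ * q)))) ⟩
        ((p + - (½ * q)) + (½ * r + - (½ * q))) + - t    ≈⟨ +-congʳ (rearrange p (½ * q) (½ * r)) ⟩
        ((p + - (½ * q + ½ * q)) + ½ * r) + - t          ≈⟨ +-congʳ (+-congʳ (+-congˡ (-‿cong ½q+½q≈q))) ⟩
        ((p + - q) + ½ * r) + - t                        ≈⟨ rearrange′ p q (½ * r) t ⟩
        ((p + - t) + - q) + ½ * r                        ∎
        where
        ½q+½q≈q : ½ * q + ½ * q ≈ q
        ½q+½q≈q = trans (sym (distribʳ q ½ ½)) (trans (*-congʳ ½+½≈1) (*-identityˡ q))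
        rearrange : ∀ p q r → (p + - q) + (r + - q) ≈ (p + - (q + q)) + r
        rearrange p q r = begin
          (p + - q) + (r + - q)       ≈⟨ solve-+ p q r ⟩
          (p + (- q + - q)) + r       ≈⟨ +-congʳ (+-congˡ (⁻¹-∙-comm q q)) ⟩
          (p + - (q + q)) + r         ∎
          where
          solve-+ : ∀ p q r → (p + - q) + (r + - q) ≈ (p + (- q + - q)) + r
          solve-+ = Solver.solve 3 (λ p q r → ((p Solver.⊕ (Solver.⊝ q)) Solver.⊕ (r Solver.⊕ (Solver.⊝ q)))
                                          Solver.⊜ ((p Solver.⊕ ((Solver.⊝ q) Solver.⊕ (Solver.⊝ q))) Solver.⊕ r)) refl
        rearrange′ : ∀ p q r t → ((p + - q) + r) + - t ≈ ((p + - t) + - q) + r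
        rearrange′ = Solver.solve 4 (λ p q r t → (((p Solver.⊕ (Solver.⊝ q)) Solver.⊕ r) Solver.⊕ (Solver.⊝ t))
                                          Solver.⊜ (((p Solver.⊕ (Solver.⊝ t)) Solver.⊕ (Solver.⊝ q)) Solver.⊕ r)) refl

  G : ℕ → M d
  G ℕ.zero = I
  G (ℕ.suc N) = step (G N)

  -- The filtration level reached by the error of G N.
  rate : ℕ → ℤ
  rate N = + (s ℕ.* ℕ.suc N)

  N≤rate : ∀ N → + N ℤ.≤ rate N
  N≤rate N = ℤ.+≤+ (NP.≤-trans (NP.n≤1+n N) (NP.m≤n*m (ℕ.suc N) s {{ℕ.>-nonZero s>0}}))

  s≤rate : ∀ N → + s ℤ.≤ rate N
  s≤rate N = ℤ.+≤+ (NP.m≤m*n s (ℕ.suc N))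

  record Invariant (N : ℕ) : Set where
    field
      commutes      : Commutes (G N)
      unipotent     : A (+ s) (G N ⊖ I)
      small-error   : A (rate N) (err (G N))
      selfAdjoint   : IsSelfAdjoint (G N)

  private
    A-flip : ∀ {m x} → A m (x ⊖ I) → A m (I ⊖ x)
    A-flip hx = A-cong (λ i j → trans (+-identityˡ _) (sym (x-y≈-[y-x] _ _))) (A-⊖ A-O hx)

    rate-suc : ∀ N → + s ℤ.+ rate N ≡ rate (ℕ.suc N)
    rate-suc N = P.trans (P.sym (ℤP.pos-+ s (s ℕ.* ℕ.suc N))) (P.cong +_ (P.sym (NP.*-suc s (ℕ.suc N))))

    rate-suc≤2rate : ∀ N → rate (ℕ.suc N) ℤ.≤ rate N ℤ.+ rate N
    rate-suc≤2rate N = ℤP.≤-trans (ℤP.≤-reflexive (P.sym (rate-suc N))) (ℤP.+-monoˡ-≤ (rate N) (s≤rate N))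

  invariant : ∀ N → Invariant N
  invariant ℕ.zero = record
    { commutes    = ≋-trans (⊙-Iˡ w) (≋-sym (⊙-Iʳ w))
    ; unipotent   = A-cong (λ i j → sym (-‿inverseʳ _)) A-O
    ; small-error = P.subst (λ t → A t (err I)) (P.cong +_ (P.sym (NP.*-identityʳ s)))
        (A-cong (λ i j → trans (+-identityˡ _) (trans (sym (x-y≈-[y-x] _ _)) (+-congʳ (sym (⊙-Iˡ I i j)))))
                (A-⊖ A-O w∈U))
    ; selfAdjoint = selfAdjoint-I }
  invariant (ℕ.suc N) = record
    { commutes    = step-commutes commutes
    ; unipotent   = A-cong (λ i j → [x-y]-z≈[x-z]-y _ _ _)
                      (A-⊖ unipotent (A-⋆ 𝔭-½ (A-mono (s≤rate N) small-error)))
    ; small-error = A-cong (≋-sym (step-err commutes))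
        (A-⊕ (P.subst (λ t → A t ((I ⊖ G N) ⊙ err (G N))) (rate-suc N) (A-⊙ (A-flip unipotent) small-error))
             (A-⋆ 𝔭-½ (A-⋆ 𝔭-½ (A-mono (rate-suc≤2rate N) (A-⊙ small-error small-error)))))
    ; selfAdjoint = selfAdjoint-⊖ selfAdjoint
                      (selfAdjoint-⋆ ρ-½ (selfAdjoint-⊖ (selfAdjoint-² selfAdjoint) w-selfAdjoint)) }
    where open Invariant (invariant N)

  -- Consecutive iterates differ by ½ err, so the sequence is Cauchy.
  cauchy : ∀ N n → N ℕ.≤ n → A (rate N) (G n ⊖ G N)
  cauchy N n N≤n = P.subst (λ m → A (rate N) (G m ⊖ G N)) (NP.m∸n+n≡m N≤n) (from-N (n ℕ.∸ N))
    where
    from-N : ∀ k → A (rate N) (G (k ℕ.+ N) ⊖ G N)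
    from-N ℕ.zero = A-cong (λ i j → sym (-‿inverseʳ _)) A-O
    from-N (ℕ.suc k) = A-cong (λ i j → [x-y]-z≈[x-z]-y _ _ _)
      (A-⊖ (from-N k) (A-⋆ 𝔭-½ (A-mono (ℤ.+≤+ (NP.*-monoʳ-≤ s (ℕ.s≤s (NP.m≤n+m N k))))
                                        (Invariant.small-error (invariant (k ℕ.+ N))))))

  open Completeness G rate N≤rate cauchy using (limit; limit-close)

  g : M d
  g = limit

  g∈U : A (+ s) (g ⊖ I)
  g∈U = P.subst (λ t → A t (g ⊖ I)) (P.cong +_ (NP.*-identityʳ s)) (limit-close 0)

  private
    A₀-of-U : ∀ {x} → A (+ s) (x ⊖ I) → A (+ 0) x
    A₀-of-U hx = A-cong (λ i j → [x-y]+y≈x _ _) (A-⊕ (A-mono (ℤ.+≤+ ℕ.z≤n) hx) A-I)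

    N-for : ℤ → ℕ
    N-for m = ℤ.∣ m ∣

    m≤rate : ∀ m → m ℤ.≤ rate (N-for m)
    m≤rate m = ℤP.≤-trans (i≤∣i∣ m) (N≤rate (N-for m))

  -- g² - w = (g - G_N) g + G_N (g - G_N) + (G_N² - w) lies in every a_m(Λ).
  g²-w∈A : ∀ m → A m (err g)
  g²-w∈A m = A-cong (≋-sym decompose)
      (A-⊕ (A-⊕ (A-mono (ℤP.≤-trans (m≤rate m) (ℤP.≤-reflexive (P.sym (ℤP.+-identityʳ _))))
                          (A-⊙ (limit-close N) (A₀-of-U g∈U)))
                (A-mono (ℤP.≤-trans (m≤rate m) (ℤP.≤-reflexive (P.sym (ℤP.+-identityˡ _))))
                          (A-⊙ (A₀-of-U (Invariant.unipotent (invariant N))) (limit-close N))))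
           (A-mono (m≤rate m) (Invariant.small-error (invariant N))))
    where
    N : ℕ
    N = N-for m
    GN : M d
    GN = G N
    decompose : err g ≋ ((g ⊖ GN) ⊙ g ⊕ GN ⊙ (g ⊖ GN)) ⊕ err GN
    decompose = ≋-trans (λ i j → trans (x-y≈[x-z]+[z-y] _ _ ((GN ⊙ GN) i j))
                                       (+-congʳ (x-y≈[x-z]+[z-y] _ _ ((GN ⊙ g) i j))))
                        (⊕-cong (⊕-cong (≋-sym (⊙-⊖ʳ g GN g)) (≋-sym (⊙-⊖ˡ GN g GN))) ≋-refl)

  g²≈w : g ⊙ g ≋ w
  g²≈w i j = x∙y⁻¹≈ε⇒x≈y _ _ (A-separated g²-w∈A i j)

  g-commutes : Commutes g
  g-commutes = ≋-trans (⊙-cong ≋-refl (≋-sym g²≈w)) (≋-trans (≋-sym (⊙-assoc g g g)) (⊙-cong g²≈w ≋-refl))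

  -- b(gv, u) - b(v, gu) is arbitrarily divisible: compare with G_N for N
  -- large, which is self-adjoint, using the continuity of h.
  g-selfAdjoint : IsSelfAdjoint g
  g-selfAdjoint v u = x∙y⁻¹≈ε⇒x≈y _ _ (𝔭^∞⇒0 _ λ k → 𝔭-mono (i≤∣i∣ k) (close ℤ.∣ k ∣))
    where
    X Y : K
    X = b (g ⊛ v) u
    Y = b v (g ⊛ u)
    close : ∀ κ → X + - Y ∈𝔭^ + κ
    close κ = 𝔭-cong (sym split) (𝔭-+ left (𝔭-+ (𝔭-zero _ middle) (𝔭-neg right)))
      where
      m₀ m₁ : ℤ
      m₀ = continuityIndex v u κ
      m₁ = continuityIndex (a ⊛ v) u κ
      N : ℕ
      N = ℤ.∣ m₀ ℤ.- n ∣ ℕ.+ ℤ.∣ m₁ ∣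
      GN : M d
      GN = G N
      X' Y' : K
      X' = b (GN ⊛ v) u
      Y' = b v (GN ⊛ u)
      m₀≤n+rate : m₀ ℤ.≤ n ℤ.+ rate N
      m₀≤n+rate = ℤP.≤-trans (ℤP.≤-reflexive (shift m₀ n)) (ℤP.+-monoʳ-≤ n
                    (ℤP.≤-trans (i≤∣i∣ (m₀ ℤ.- n)) (ℤP.≤-trans (ℤ.+≤+ (NP.m≤m+n _ _)) (N≤rate N))))
        where shift : ∀ a c → a ≡ c ℤ.+ (a ℤ.- c)
              shift = solve-∀
      m₁≤rate : m₁ ℤ.≤ rate N
      m₁≤rate = ℤP.≤-trans (i≤∣i∣ m₁) (ℤP.≤-trans (ℤ.+≤+ (NP.m≤n+m _ _)) (N≤rate N))
      left : X + - X' ∈𝔭^ + κ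
      left = 𝔭-cong (trans (h-cong ($-⊙ a (g ⊖ GN) v) (λ i → refl)) (b-⊖ˡ g GN v u))
               (h-continuousˡ v u κ (n ℤ.+ rate N) (a ⊙ (g ⊖ GN)) m₀≤n+rate (A-⊙ a∈A (limit-close N)))
      right : Y + - Y' ∈𝔭^ + κ
      right = 𝔭-cong (b-⊖ʳ g GN v u) (h-continuousʳ (a ⊛ v) u κ (rate N) (g ⊖ GN) m₁≤rate (limit-close N))
      middle : X' + - Y' ≈ 0#
      middle = trans (+-congʳ (Invariant.selfAdjoint (invariant N) v u)) (-‿inverseʳ _)
      split : X + - Y ≈ (X + - X') + ((X' + - Y') + - (Y + - Y'))
      split = trans (x-y≈[x-z]+[z-y] X Y X') (+-congˡ (x-y≈[x-z]-[y-z] X' Y Y'))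

-- We study w = a₂⁻¹a₁ ∈ Ũ^s(Λ): an isometry
-- (V, h_{a₁}) → (V, h_{a₂}) in Ũ^s(Λ) is the same as a square root of w
-- in Ũ^s(Λ) that is self-adjoint for h_{a₂}.
module Isometry (R : CommutativeRing 0ℓ 0ℓ) (F : IsNALocalField R)
    (odd : OddResidualChar R F)
    (π : CommutativeRing.Carrier R) (valπ : IsNALocalField.val F π ≡ just (+ 1))
    (d : ℕ) (Λ : ℤ → Subset R F d) (LS : IsLatticeSequence R F π Λ)
    (ρ : CommutativeRing.Carrier R → CommutativeRing.Carrier R) (ρA : IsAutOrderLe2 R ρ)
    (ρπ : CommutativeRing._≈_ R (ρ π) π ⊎ CommutativeRing._≈_ R (ρ π) (CommutativeRing.-_ R π))
    (ε : CommutativeRing.Carrier R) (h : Form R d) (H : IsNondegEpsHermitian R ρ ε h)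
    (SD : IsSelfDual R F h Λ)
    (s : ℕ) (s>0 : 0 ℕ.< s)
    (a₁ a₂ : Mat R d) (δ₁ δ₂ : CommutativeRing.Carrier R)
    (a₁-sign : ∀ v w → CommutativeRing._≈_ R (h (_$_ R a₁ v) w) (CommutativeRing._*_ R δ₁ (h v (_$_ R a₁ w))))
    (a₂-sign : ∀ v w → CommutativeRing._≈_ R (h (_$_ R a₂ v) w) (CommutativeRing._*_ R δ₂ (h v (_$_ R a₂ w))))
    (δ₂²≈1 : CommutativeRing._≈_ R (CommutativeRing._*_ R δ₂ δ₂) (CommutativeRing.1# R))
    (a₁∈𝔫 : InNormalizer R F Λ a₁) (a₂∈𝔫 : InNormalizer R F Λ a₂)
    (a₂⁻¹ : Mat R d) (a₂-inverse : IsInverse R a₂ a₂⁻¹)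
    (a₁a₂⁻¹∈U : InU R F Λ (+ s) (_∘ₘ_ R a₁ a₂⁻¹)) where
  open CommutativeRing R renaming (Carrier to K) hiding (zero)
  open Matrices R
  open Valuation R F
  open LatticeSequence R F π valπ d Λ LS
  open HermitianForm R ρ ρA ε h H
  open Duality R F π valπ d Λ LS ρ ρA ρπ ε h H SD
  open IsNondegEpsHermitian H
  open Equivalence

  n₂ : ℤ
  n₂ = proj₁ (proj₂ (proj₂ a₂∈𝔫))

  a₂∈A : A n₂ a₂
  a₂∈A = proj₁ (proj₁ (proj₂ (proj₂ (proj₂ a₂∈𝔫))))

  a₂⁻¹∈A : A (ℤ.- n₂) a₂⁻¹
  a₂⁻¹∈A = A-cong (≋-sym (inverse-unique (proj₁ a₂-inverse) (proj₂ (proj₁ (proj₂ a₂∈𝔫)))))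
                  (proj₁ (proj₂ (proj₂ (proj₂ (proj₂ a₂∈𝔫)))))

  w : M d
  w = a₂⁻¹ ⊙ a₁

  y : M d
  y = a₁ ⊙ a₂⁻¹ ⊖ I

  z : M d
  z = w ⊖ I

  a₂w≈a₁ : ∀ v → a₂ ⊛ (w ⊛ v) ≈v a₁ ⊛ v
  a₂w≈a₁ v = ≈v-trans (≈v-sym ($-⊙ a₂ w v)) ($-cong (≋-trans (≋-sym (⊙-assoc a₂ a₂⁻¹ a₁))
                          (≋-trans (⊙-cong (proj₁ a₂-inverse) ≋-refl) (⊙-Iˡ a₁))) ≈v-refl)

  a₂-sign′ : ∀ v u → h v (a₂ ⊛ u) ≈ δ₂ * h (a₂ ⊛ v) u
  a₂-sign′ v u = sym (trans (*-congˡ (a₂-sign v u))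
                   (trans (sym (*-assoc _ _ _)) (trans (*-congʳ δ₂²≈1) (*-identityˡ _))))

  -- w - 1 = a₂⁻¹ (a₁a₂⁻¹ - 1) a₂ ∈ a_{-n₂ + s + n₂}(Λ) = a_s(Λ).
  w∈U : A (+ s) z
  w∈U = A-cong (≋-sym conjugate)
          (P.subst (λ t → A t ((a₂⁻¹ ⊙ y) ⊙ a₂)) (cancel (+ s) n₂) (A-⊙ (A-⊙ a₂⁻¹∈A a₁a₂⁻¹∈U) a₂∈A))
    where
    cancel : ∀ s n → ℤ.- n ℤ.+ s ℤ.+ n ≡ s
    cancel = solve-∀
    conjugate : z ≋ (a₂⁻¹ ⊙ y) ⊙ a₂
    conjugate = begin
      a₂⁻¹ ⊙ a₁ ⊖ I                         ≈⟨ ⊖-cong ≋-refl (≋-sym (proj₂ a₂-inverse)) ⟩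
      a₂⁻¹ ⊙ a₁ ⊖ a₂⁻¹ ⊙ a₂                 ≈⟨ ≋-sym (⊙-⊖ˡ a₂⁻¹ a₁ a₂) ⟩
      a₂⁻¹ ⊙ (a₁ ⊖ a₂)                      ≈⟨ ⊙-cong ≋-refl (⊖-cong a₁≋a₁a₂⁻¹a₂ (≋-sym (⊙-Iˡ a₂))) ⟩
      a₂⁻¹ ⊙ ((a₁ ⊙ a₂⁻¹) ⊙ a₂ ⊖ I ⊙ a₂)    ≈⟨ ⊙-cong ≋-refl (≋-sym (⊙-⊖ʳ (a₁ ⊙ a₂⁻¹) I a₂)) ⟩
      a₂⁻¹ ⊙ (y ⊙ a₂)                       ≈⟨ ≋-sym (⊙-assoc a₂⁻¹ y a₂) ⟩
      (a₂⁻¹ ⊙ y) ⊙ a₂                       ∎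
      where
      open ≋-Reasoning
      a₁≋a₁a₂⁻¹a₂ : a₁ ≋ (a₁ ⊙ a₂⁻¹) ⊙ a₂
      a₁≋a₁a₂⁻¹a₂ = ≋-sym (≋-trans (⊙-assoc a₁ a₂⁻¹ a₂) (≋-trans (⊙-cong ≋-refl (proj₂ a₂-inverse)) (⊙-Iʳ a₁)))

  private
    [x-I]v+v : ∀ (x : M d) v → (x ⊖ I) ⊛ v +v v ≈v x ⊛ v
    [x-I]v+v x v i = trans (+-congʳ (trans ($-⊖ x I v i) (+-congˡ (-‿cong ($-I v i))))) ([x-y]+y≈x _ _)

  -- h((a₁a₂⁻¹)v, q) = δ₁δ₂ h(v, (a₂⁻¹a₁)q), written with y = a₁a₂⁻¹ - 1, z = w - 1.
  key-identity : ∀ v q → h (y ⊛ v) q + h v q ≈ δ₁ * (δ₂ * (h v (z ⊛ q) + h v q))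
  key-identity v q = begin
    h (y ⊛ v) q + h v q                       ≈⟨ sym (h-+ˡ (y ⊛ v) v q) ⟩
    h (y ⊛ v +v v) q                          ≈⟨ h-cong (≈v-trans ([x-I]v+v (a₁ ⊙ a₂⁻¹) v) ($-⊙ a₁ a₂⁻¹ v)) (λ i → refl) ⟩
    h (a₁ ⊛ (a₂⁻¹ ⊛ v)) q                     ≈⟨ a₁-sign (a₂⁻¹ ⊛ v) q ⟩
    δ₁ * h (a₂⁻¹ ⊛ v) (a₁ ⊛ q)                ≈⟨ *-congˡ (h-cong (λ i → refl) (≈v-sym (a₂w≈a₁ q))) ⟩
    δ₁ * h (a₂⁻¹ ⊛ v) (a₂ ⊛ (w ⊛ q))          ≈⟨ *-congˡ (a₂-sign′ (a₂⁻¹ ⊛ v) (w ⊛ q)) ⟩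
    δ₁ * (δ₂ * h (a₂ ⊛ (a₂⁻¹ ⊛ v)) (w ⊛ q))   ≈⟨ *-congˡ (*-congˡ (h-cong (inverse-action (proj₁ a₂-inverse) v)
                                                                          (≈v-sym ([x-I]v+v w q)))) ⟩
    δ₁ * (δ₂ * h v (z ⊛ q +v q))              ≈⟨ *-congˡ (*-congˡ (h-+ʳ v (z ⊛ q) q)) ⟩
    δ₁ * (δ₂ * (h v (z ⊛ q) + h v q))         ∎
    where open ≈-Reasoning

  -- Opposite signs are impossible (for V ≠ 0): the key identity gives
  -- 2h(Λ_r, Λ_{u-r-s}) ⊆ 𝔭, hence Λ_r ⊆ Λ_{r+s} by self-duality (2 is a
  -- unit), so Λ_0 ⊆ ∩_k Λ_{ks} = 0.
  module OppositeSigns (δ₁δ₂≈-1 : δ₁ * δ₂ ≈ - 1#) where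
    open Valuation.Half R F odd using (𝔭-halve)

    pairing-in-𝔭 : ∀ r {v q} → Λ r v → Λ (u ℤ.- (r ℤ.+ + s)) q → h v q ∈𝔭^ + 1
    pairing-in-𝔭 r {v} {q} v∈ hq = 𝔭-halve (𝔭-cong (sym twice) (𝔭-neg (𝔭-+ hyv hzq)))
      where
      hyv : h (y ⊛ v) q ∈𝔭^ + 1
      hyv = dualityˡ (r ℤ.+ + s) (a₁a₂⁻¹∈U r v v∈) hq
      zq∈ : Λ (u ℤ.- r) (z ⊛ q)
      zq∈ = P.subst (λ t → Λ t (z ⊛ q)) (cancel u r (+ s)) (w∈U _ q hq)
        where cancel : ∀ u r s → u ℤ.- (r ℤ.+ s) ℤ.+ s ≡ u ℤ.- r
              cancel = solve-∀
      hzq : h v (z ⊛ q) ∈𝔭^ + 1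
      hzq = dualityˡ r v∈ zq∈
      -- with A = h(yv,q), B = h(v,q), C = h(v,zq): A + B = -(C + B), so 2B = -(A + C)
      twice : (1# + 1#) * h v q ≈ - (h (y ⊛ v) q + h v (z ⊛ q))
      twice = double-from-key (trans (key-identity v q)
                (trans (sym (*-assoc _ _ _)) (trans (*-congʳ δ₁δ₂≈-1) (-1*x≈-x _))))
        where
        double-from-key : ∀ {A B C} → A + B ≈ - (C + B) → (1# + 1#) * B ≈ - (A + C)
        double-from-key {A} {B} {C} A+B≈-[C+B] = inverseˡ-unique _ _ (begin
          (1# + 1#) * B + (A + C)    ≈⟨ +-congʳ (trans (distribʳ B 1# 1#) (+-cong (*-identityˡ B) (*-identityˡ B))) ⟩
          (B + B) + (A + C)          ≈⟨ regroup A B C ⟩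
          (A + B) + (C + B)          ≈⟨ +-congʳ A+B≈-[C+B] ⟩
          - (C + B) + (C + B)        ≈⟨ -‿inverseˡ _ ⟩
          0#                         ∎)
          where
          open ≈-Reasoning
          regroup : ∀ A B C → (B + B) + (A + C) ≈ (A + B) + (C + B)
          regroup = Solver.solve 3 (λ A B C → ((B Solver.⊕ B) Solver.⊕ (A Solver.⊕ C))
                                              Solver.⊜ ((A Solver.⊕ B) Solver.⊕ (C Solver.⊕ B))) refl

    Λ-step : ∀ r {v} → Λ r v → Λ (r ℤ.+ + s) v
    Λ-step r {v} hv = P.subst (λ t → Λ t v) (cancel u r (+ s))
                        (to (proj₂ SD (u ℤ.- (r ℤ.+ + s)) v) (λ q hq → pairing-in-𝔭 r hv hq))
      where cancel : ∀ u r s → u ℤ.- (u ℤ.- (r ℤ.+ s)) ≡ r ℤ.+ s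
            cancel = solve-∀

    Λ₀⊆Λ[ks] : ∀ k {v} → Λ (+ 0) v → Λ (+ (k ℕ.* s)) v
    Λ₀⊆Λ[ks] ℕ.zero hv = hv
    Λ₀⊆Λ[ks] (ℕ.suc k) {v} hv = P.subst (λ t → Λ t v)
      (P.trans (P.sym (ℤP.pos-+ (k ℕ.* s) s)) (P.cong +_ (NP.+-comm (k ℕ.* s) s))) (Λ-step _ (Λ₀⊆Λ[ks] k hv))

    impossible : Fin d → ⊥
    impossible j = Λ₀-nontrivial j λ v hv → Λ-separated λ k →
      Λ-mono (ℤ.+≤+ (NP.m≤m*n k s {{ℕ.>-nonZero s>0}})) (Λ₀⊆Λ[ks] k hv)

  -- Equal signs: w is self-adjoint for h_{a₂}, so Newton's iteration gives a
  -- self-adjoint square root g ∈ Ũ^s(Λ) of w, which is the isometry.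
  module EqualSigns (δ₁δ₂≈1 : δ₁ * δ₂ ≈ 1#) where
    a₁⁻¹ : M d
    a₁⁻¹ = proj₁ a₁∈𝔫

    a₁-inverse : IsInverse R a₁ a₁⁻¹
    a₁-inverse = proj₁ (proj₂ a₁∈𝔫)

    open SelfAdjoint R ρ ρA ε h H a₂

    w-selfAdjoint : IsSelfAdjoint w
    w-selfAdjoint v u = begin
      h (a₂ ⊛ (w ⊛ v)) u              ≈⟨ h-cong (a₂w≈a₁ v) (λ i → refl) ⟩
      h (a₁ ⊛ v) u                    ≈⟨ a₁-sign v u ⟩
      δ₁ * h v (a₁ ⊛ u)               ≈⟨ *-congˡ (h-cong (λ i → refl) (≈v-sym (a₂w≈a₁ u))) ⟩
      δ₁ * h v (a₂ ⊛ (w ⊛ u))         ≈⟨ *-congˡ (a₂-sign′ v (w ⊛ u)) ⟩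
      δ₁ * (δ₂ * h (a₂ ⊛ v) (w ⊛ u))  ≈⟨ trans (sym (*-assoc _ _ _)) (trans (*-congʳ δ₁δ₂≈1) (*-identityˡ _)) ⟩
      h (a₂ ⊛ v) (w ⊛ u)              ∎
      where open ≈-Reasoning

    open NewtonSquareRoot R F odd π valπ d Λ LS ρ ρA ρπ ε h H SD s s>0 a₂ n₂ a₂∈A w w∈U w-selfAdjoint
      using (g; g∈U; g²≈w; g-commutes; g-selfAdjoint)

    g-isometric : ∀ v u → h (g ⊛ v) (a₂ ⊛ (g ⊛ u)) ≈ h v (a₁ ⊛ u)
    g-isometric v u = begin
      h (g ⊛ v) (a₂ ⊛ (g ⊛ u))        ≈⟨ a₂-sign′ (g ⊛ v) (g ⊛ u) ⟩
      δ₂ * b (g ⊛ v) (g ⊛ u)          ≈⟨ *-congˡ (g-selfAdjoint v (g ⊛ u)) ⟩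
      δ₂ * b v (g ⊛ (g ⊛ u))          ≈⟨ *-congˡ (h-cong (λ i → refl) (≈v-trans (≈v-sym ($-⊙ g g u)) ($-cong g²≈w ≈v-refl))) ⟩
      δ₂ * h (a₂ ⊛ v) (w ⊛ u)         ≈⟨ *-congˡ (a₂-sign v (w ⊛ u)) ⟩
      δ₂ * (δ₂ * h v (a₂ ⊛ (w ⊛ u)))  ≈⟨ trans (sym (*-assoc _ _ _)) (trans (*-congʳ δ₂²≈1) (*-identityˡ _)) ⟩
      h v (a₂ ⊛ (w ⊛ u))              ≈⟨ h-cong (λ i → refl) (a₂w≈a₁ u) ⟩
      h v (a₁ ⊛ u)                    ∎
      where open ≈-Reasoning

    -- g⁻¹ = g w⁻¹ with w⁻¹ = a₁⁻¹a₂, using g² = w and gw = wg.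
    w⁻¹ : M d
    w⁻¹ = a₁⁻¹ ⊙ a₂

    ww⁻¹≋I : w ⊙ w⁻¹ ≋ I
    ww⁻¹≋I = begin
      (a₂⁻¹ ⊙ a₁) ⊙ (a₁⁻¹ ⊙ a₂)       ≈⟨ ⊙-assoc a₂⁻¹ a₁ (a₁⁻¹ ⊙ a₂) ⟩
      a₂⁻¹ ⊙ (a₁ ⊙ (a₁⁻¹ ⊙ a₂))       ≈⟨ ⊙-cong ≋-refl (≋-sym (⊙-assoc a₁ a₁⁻¹ a₂)) ⟩
      a₂⁻¹ ⊙ ((a₁ ⊙ a₁⁻¹) ⊙ a₂)       ≈⟨ ⊙-cong ≋-refl (≋-trans (⊙-cong (proj₁ a₁-inverse) ≋-refl) (⊙-Iˡ a₂)) ⟩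
      a₂⁻¹ ⊙ a₂                       ≈⟨ proj₂ a₂-inverse ⟩
      I                               ∎
      where open ≋-Reasoning

    w⁻¹w≋I : w⁻¹ ⊙ w ≋ I
    w⁻¹w≋I = begin
      (a₁⁻¹ ⊙ a₂) ⊙ (a₂⁻¹ ⊙ a₁)       ≈⟨ ⊙-assoc a₁⁻¹ a₂ (a₂⁻¹ ⊙ a₁) ⟩
      a₁⁻¹ ⊙ (a₂ ⊙ (a₂⁻¹ ⊙ a₁))       ≈⟨ ⊙-cong ≋-refl (≋-sym (⊙-assoc a₂ a₂⁻¹ a₁)) ⟩
      a₁⁻¹ ⊙ ((a₂ ⊙ a₂⁻¹) ⊙ a₁)       ≈⟨ ⊙-cong ≋-refl (≋-trans (⊙-cong (proj₁ a₂-inverse) ≋-refl) (⊙-Iˡ a₁)) ⟩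
      a₁⁻¹ ⊙ a₁                       ≈⟨ proj₂ a₁-inverse ⟩
      I                               ∎
      where open ≋-Reasoning

    g-invertible : Invertible R g
    g-invertible = g ⊙ w⁻¹ , gg⁻¹≋I , g⁻¹g≋I
      where
      gg⁻¹≋I : g ⊙ (g ⊙ w⁻¹) ≋ I
      gg⁻¹≋I = ≋-trans (≋-sym (⊙-assoc g g w⁻¹)) (≋-trans (⊙-cong g²≈w ≋-refl) ww⁻¹≋I)
      g⁻¹g≋I : (g ⊙ w⁻¹) ⊙ g ≋ I
      g⁻¹g≋I = ≋-trans (⊙-assoc g w⁻¹ g)
                 (≋-trans (⊙-cong ≋-refl (commutes-inverse g-commutes ww⁻¹≋I w⁻¹w≋I)) gg⁻¹≋I)

    root-isometry : Σ (M d) λ g → IsIsometry R (twist R h a₁) (twist R h a₂) g × InU R F Λ (+ s) g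
    root-isometry = g , (g-invertible , g-isometric) , g∈U

  -- The theorem for V ≠ 0 (witnessed by an index j), by the sign of δ₁δ₂.
  isometry : Signs.IsSign R (δ₁ * δ₂) → Fin d →
             Σ (M d) λ g → IsIsometry R (twist R h a₁) (twist R h a₂) g × InU R F Λ (+ s) g
  isometry (inj₁ δ₁δ₂≈1) _ = EqualSigns.root-isometry δ₁δ₂≈1
  isometry (inj₂ δ₁δ₂≈-1) j = ⊥-elim (OppositeSigns.impossible δ₁δ₂≈-1 j)

nonzero⇒index : ∀ (R : CommutativeRing 0ℓ 0ℓ) {d} (a : Mat R d) → ¬ _≈ₘ_ R a (0ₘ R) → Fin d
nonzero⇒index R {ℕ.zero} a a≢0 = ⊥-elim (a≢0 (λ ()))
nonzero⇒index R {ℕ.suc d} a a≢0 = zero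

-- The theorem: determine the signs of a₁, a₂ and apply Isometry.isometry.
lemma5p3 : (R : CommutativeRing 0ℓ 0ℓ) (F : IsNALocalField R) →
    OddResidualChar R F →
    (ρ : CommutativeRing.Carrier R → CommutativeRing.Carrier R) → IsAutOrderLe2 R ρ →
    (π : CommutativeRing.Carrier R) → IsNALocalField.val F π ≡ just (+ 1) →
    (CommutativeRing._≈_ R (ρ π) π ⊎ CommutativeRing._≈_ R (ρ π) (CommutativeRing.-_ R π)) →
    (ε : CommutativeRing.Carrier R) →
    (CommutativeRing._≈_ R ε (CommutativeRing.1# R) ⊎ CommutativeRing._≈_ R ε (CommutativeRing.-_ R (CommutativeRing.1# R))) →
    (d : ℕ) (h : Form R d) → IsNondegEpsHermitian R ρ ε h →
    (Λ : ℤ → Subset R F d) → IsLatticeSequence R F π Λ → IsSelfDual R F h Λ →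
    (a₁ a₂ : Mat R d) →
    ¬ _≈ₘ_ R a₁ (0ₘ R) → ¬ _≈ₘ_ R a₂ (0ₘ R) →
    InNormalizer R F Λ a₁ → InNormalizer R F Λ a₂ →
    (IsSymmetric R h a₁ ⊎ IsSkew R h a₁) → (IsSymmetric R h a₂ ⊎ IsSkew R h a₂) →
    (s : ℕ) → 0 ℕ.< s →
    (Σ (Mat R d) λ a₂⁻¹ → IsInverse R a₂ a₂⁻¹ × InU R F Λ (+ s) (_∘ₘ_ R a₁ a₂⁻¹)) →
    Σ (Mat R d) λ g → IsIsometry R (twist R h a₁) (twist R h a₂) g × InU R F Λ (+ s) g
lemma5p3 R F odd ρ ρA π valπ ρπ ε _ d h H Λ LS SD a₁ a₂ a₁≢0 _ a₁∈𝔫 a₂∈𝔫 a₁-type a₂-type s s>0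
         (a₂⁻¹ , a₂-inverse , a₁a₂⁻¹∈U)
  with Signs.sign-of R h a₁ a₁-type | Signs.sign-of R h a₂ a₂-type
... | δ₁ , δ₁-sign , a₁-sign | δ₂ , δ₂-sign , a₂-sign =
  Isometry.isometry R F odd π valπ d Λ LS ρ ρA ρπ ε h H SD s s>0 a₁ a₂ δ₁ δ₂ a₁-sign a₂-sign
    (sign² δ₂-sign) a₁∈𝔫 a₂∈𝔫 a₂⁻¹ a₂-inverse a₁a₂⁻¹∈U
    (sign-product δ₁-sign δ₂-sign) (nonzero⇒index R a₁ a₁≢0)
  where open Signs R using (sign²; sign-product)
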